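{- Let $\mathcal{P}$ be one of $Q^-(2r+1,q)$ ($e=2$), $W(2r-1,q)$ ($e=1$), or $H(2r,q)$ with $q$ square ($e=\frac32$), with ambient space $PG(n,q)$, $n=2r+2e-3$, and let $\mu$ be a weighted $m$-ovoid of $\mathcal{P}$. Then for every $j$-dimensional subspace $\pi$ of $PG(n,q)$, $$\mu(\pi^\perp)+q^{r+e-j-2}\mu(\pi)=m(q^{r+e-j-2}+1).$$
   Context: These are finite classical polar spaces of rank $r$ (elliptic quadric in $PG(2r+1,q)$, symplectic polar space in $PG(2r-1,q)$, Hermitian polar space in $PG(2r,q)$); generators have projective dimension $r-1$. $\perp$ denotes the polarity of $PG(n,q)$ associated with the polar space (for a quadric in even characteristic, the polarity of the associated bilinear form $f(u,v)=Q(u+v)-Q(u)-Q(v)$). A weighted $m$-ovoid is a function $\mu$ assigning a non-negative integer to each point of the polar space (extended by $0$ to the other points of $PG(n,q)$), extended to subspaces $\pi$ of $PG(n,q)$ by $\mu(\pi)=\sum_{p\in\pi}\mu(p)$, such that for every point $p$ of $PG(n,q)$: $\mu(p^\perp)+q^{r+e-2}\mu(p)=m(q^{r+e-2}+1)$. -}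

module Defs where

open import Level using (0ℓ)
open import Data.Bool using (Bool; true; false; not; _∧_; _∨_; if_then_else_)
open import Data.Nat as ℕ using (ℕ; zero; suc)
open import Data.Integer as ℤ using (ℤ; +_; -[1+_])
open import Data.List using (List; []; _∷_; length; map; concatMap; filterᵇ)
open import Data.Bool.ListAction using (all; any)
open import Data.Nat.ListAction using (sum)
open import Data.List.Membership.Propositional using (_∈_)
open import Data.List.Relation.Unary.Unique.Propositional using (Unique)
open import Data.Vec as Vec using (Vec; []; _∷_)
open import Data.Fin as Fn using (Fin)
open import Data.Product using (_×_)
open import Relation.Nullary using (¬_; does)
open import Relation.Binary.Definitions using (DecidableEquality)
open import Relation.Binary.PropositionalEquality using (_≡_)
open import Algebra.Structures using (IsCommutativeRing)

record FiniteField : Set₁ where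
  infixl 6 _+_ _-_
  infixl 7 _*_
  field
    Carrier   : Set
    _+_ _*_   : Carrier → Carrier → Carrier
    -_        : Carrier → Carrier
    0# 1#     : Carrier
    isCommutativeRing : IsCommutativeRing _≡_ _+_ _*_ -_ 0# 1#
    0≢1       : ¬ (0# ≡ 1#)
    _⁻¹       : Carrier → Carrier
    inverseʳ  : ∀ x → ¬ (x ≡ 0#) → x * (x ⁻¹) ≡ 1#
    _≟_       : DecidableEquality Carrier
    elements  : List Carrier
    elements-unique   : Unique elements
    elements-complete : ∀ x → x ∈ elements

  _-_ : Carrier → Carrier → Carrier
  x - y = x + (- y)

  order : ℕ
  order = length elements

  _==_ : Carrier → Carrier → Bool
  x == y = does (x ≟ y)

  _^_ : Carrier → ℕ → Carrier
  x ^ zero  = 1#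
  x ^ suc k = x * (x ^ k)

module Geometry (F : FiniteField) where
  open FiniteField F

  -- vectors of F^N (homogeneous coordinates of PG(N-1,q))
  V : ℕ → Set
  V N = Vec Carrier N

  _==ᵥ_ : ∀ {N} → V N → V N → Bool
  [] ==ᵥ [] = true
  (x ∷ xs) ==ᵥ (y ∷ ys) = (x == y) ∧ (xs ==ᵥ ys)

  _+ᵥ_ : ∀ {N} → V N → V N → V N
  _+ᵥ_ = Vec.zipWith _+_

  _·_ : ∀ {N} → Carrier → V N → V N
  a · v = Vec.map (a *_) v

  zeroᵥ : ∀ {N} → V N
  zeroᵥ = Vec.replicate _ 0#

  allVecs : (N : ℕ) → List (V N)
  allVecs zero    = [] ∷ []
  allVecs (suc N) = concatMap (λ x → map (x ∷_) (allVecs N)) elements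

  -- normalised vectors: non-zero with first non-zero coordinate 1.
  -- These are exactly one representative per point of PG(N-1,q).
  normalised : ∀ {N} → V N → Bool
  normalised []       = false
  normalised (x ∷ xs) = if x == 0# then normalised xs else (x == 1#)

  points : (N : ℕ) → List (V N)
  points N = filterᵇ normalised (allVecs N)

  lincomb : ∀ {N d} → Vec Carrier d → (Fin d → V N) → V N
  lincomb []       b = zeroᵥ
  lincomb (c ∷ cs) b = (c · b Fn.zero) +ᵥ lincomb cs (λ i → b (Fn.suc i))

  LinearlyIndependent : ∀ {N d} → (Fin d → V N) → Set
  LinearlyIndependent {N} {d} b =
    ∀ (c : Vec Carrier d) → lincomb c b ≡ zeroᵥ → c ≡ zeroᵥ

  -- a (projective) subspace of PG(N-1,q) of projective dimension d-1,
  -- given by a basis of d linearly independent vectors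
  record Subspace (N d : ℕ) : Set where
    field
      basis       : Fin d → V N
      independent : LinearlyIndependent basis
  open Subspace public

  inSpan : ∀ {N d} → Subspace N d → V N → Bool
  inSpan {d = d} π v = any (λ c → lincomb c (basis π) ==ᵥ v) (allVecs d)

  inPerp : ∀ {N d} → (V N → V N → Carrier) → Subspace N d → V N → Bool
  inPerp {d = d} B π v = all (λ c → B (lincomb c (basis π)) v == 0#) (allVecs d)

  weightOf : ∀ {N} → (V N → ℕ) → (V N → Bool) → ℕ
  weightOf {N} μ S = sum (map μ (filterᵇ S (points N)))

module PolarSpaces (F : FiniteField) where
  open FiniteField F
  open Geometry F

  pairSum : ∀ {n} → Vec Carrier n → Carrier
  pairSum (x ∷ y ∷ rest) = x * y + pairSum rest
  pairSum _              = 0#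

  sympl : ∀ {n} → Vec Carrier n → Vec Carrier n → Carrier
  sympl (x₀ ∷ x₁ ∷ xs) (y₀ ∷ y₁ ∷ ys) = (x₀ * y₁ - x₁ * y₀) + sympl xs ys
  sympl _ _ = 0#

  Anisotropic : Carrier → Carrier → Carrier → Set
  Anisotropic α β γ = ∀ x y →
    α * x * x + β * x * y + γ * y * y ≡ 0# → (x ≡ 0#) × (y ≡ 0#)

  data PolarSpace (r : ℕ) : Set where
    -- Q⁻(2r+1,q): Q(x) = α x₀² + β x₀x₁ + γ x₁² + x₂x₃ + … + x_{2r}x_{2r+1}
    ellipticQuadric : (α β γ : Carrier) → Anisotropic α β γ → PolarSpace r
    -- W(2r-1,q): standard symplectic form on F^{2r}
    symplectic      : PolarSpace r
    -- H(2r,q), q = s², Hermitian form Σ x_i y_i^s on F^{2r+1}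
    hermitian       : (s : ℕ) → s ℕ.* s ≡ order → PolarSpace r

  module _ {r : ℕ} where
    -- number of homogeneous coordinates: n + 1 where n = 2r+2e-3
    coords : PolarSpace r → ℕ
    coords (ellipticQuadric _ _ _ _) = 2 ℕ.+ 2 ℕ.* r
    coords symplectic                = 2 ℕ.* r
    coords (hermitian _ _)           = 1 ℕ.+ 2 ℕ.* r

    quadForm : (α β γ : Carrier) → Vec Carrier (2 ℕ.+ 2 ℕ.* r) → Carrier
    quadForm α β γ (x ∷ y ∷ rest) = α * x * x + β * x * y + γ * y * y + pairSum rest

    form : (P : PolarSpace r) → V (coords P) → V (coords P) → Carrier
    form (ellipticQuadric α β γ _) u v =
      quadForm α β γ (u +ᵥ v) - quadForm α β γ u - quadForm α β γ v
    form symplectic u v = sympl u v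
    form (hermitian s _) u v =
      Vec.foldr _ _+_ 0# (Vec.zipWith (λ a b → a * (b ^ s)) u v)

    isPoint : (P : PolarSpace r) → V (coords P) → Bool
    isPoint (ellipticQuadric α β γ _) v = quadForm α β γ v == 0#
    isPoint symplectic _                = true
    isPoint (hermitian s e) v           = form (hermitian s e) v v == 0#

    -- To express q^{r+e-j-2} for e ∈ {2,1,3/2} with integer exponents we
    -- write it as base^expo: base = q for Q⁻ and W, base = s = √q for H.
    -- Argument d = j + 1 (vector dimension of π).
    base : PolarSpace r → ℕ
    base (ellipticQuadric _ _ _ _) = order
    base symplectic                = order
    base (hermitian s _)           = s

    expo : PolarSpace r → ℕ → ℤ
    expo (ellipticQuadric _ _ _ _) d = + (r ℕ.+ 1) ℤ.- + d   -- r+2-j-2, j = d-1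
    expo symplectic                d = + r ℤ.- + d           -- r+1-j-2
    expo (hermitian _ _)           d = + (2 ℕ.* r ℕ.+ 1) ℤ.- + (2 ℕ.* d) -- 2(r+3/2-j-2)

  -- x + b^k y = m (b^k + 1) for integer k (for k < 0 both sides are
  -- multiplied by b^{-k} > 0 to stay in ℕ)
  WeightEq : (b : ℕ) (k : ℤ) (x y m : ℕ) → Set
  WeightEq b (+ n)    x y m = x ℕ.+ b ℕ.^ n ℕ.* y ≡ m ℕ.* (b ℕ.^ n ℕ.+ 1)
  WeightEq b -[1+ n ] x y m =
    b ℕ.^ suc n ℕ.* x ℕ.+ y ≡ m ℕ.* (1 ℕ.+ b ℕ.^ suc n)

  module _ {r : ℕ} (P : PolarSpace r) where
    μ̃ : (V (coords P) → ℕ) → V (coords P) → ℕ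
    μ̃ μ v = if isPoint P v then μ v else 0

    μ[_] : ∀ {d} → (V (coords P) → ℕ) → Subspace (coords P) d → ℕ
    μ[_] μ π = weightOf (μ̃ μ) (inSpan π)

    μ[_⊥] : ∀ {d} → (V (coords P) → ℕ) → Subspace (coords P) d → ℕ
    μ[_⊥] μ π = weightOf (μ̃ μ) (inPerp (form P) π)

    -- μ is a weighted m-ovoid: for every point p of PG(n,q),
    -- μ(p^⊥) + q^{r+e-2} μ(p) = m(q^{r+e-2}+1).
    -- (μ is only evaluated on normalised vectors, i.e. on points.)
    WeightedOvoid : (V (coords P) → ℕ) → ℕ → Set
    WeightedOvoid μ m =
      ∀ (p : V (coords P)) → normalised p ≡ true →
        WeightEq (base P) (expo P 1)
          (weightOf (μ̃ μ) (λ v → form P p v == 0#)) (μ̃ μ p) m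

{-# OPTIONS --safe #-}
-- Double counting. For a subspace π (of vector dimension d) count the pairs (p, x) with p a point
-- of π, x a point of the polar space and p ⊥ x, each weighted by μ(x). Summing the ovoid equation
-- over the points p of π gives θ·m(u + 1) − u·μ(π), where u = q^(r+e−2) and θ is the number of
-- points of π. Counting by x instead, π ∩ x^⊥ is π for x ∈ π^⊥ and a hyperplane of π otherwise,
-- which expresses the same number through μ(π^⊥) and the total weight μ(P). For π the whole space,
-- nondegeneracy gives π^⊥ = ∅ and q^(n+1) = (qu)², whence μ(P) = m(qu + 1); substituting this and
-- dividing by q − 1 leaves q^d·μ(π^⊥) + qu·μ(π) = m(q^d + qu), the claim up to a power of q.
module Submission where

open import Defs
open import Data.Bool using (Bool; true; false; if_then_else_; not; _∧_)
open import Data.Bool.ListAction using (all; any)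
open import Data.Empty using (⊥; ⊥-elim)
open import Data.Fin using (Fin; zero; suc)
import Data.Integer as ℤ
import Data.Integer.Properties as ℤₚ
open import Data.List using (List; []; _∷_; map; concatMap; filterᵇ; length; _++_)
open import Data.List.Membership.Propositional using (_∈_; _∉_; lose)
open import Data.List.Membership.Propositional.Properties using (∈-map⁺; ∈-concatMap⁺)
open import Data.List.Relation.Unary.All using (All; []; _∷_)
open import Data.List.Relation.Unary.Any using (here; there)
open import Data.List.Relation.Unary.Unique.Propositional using (Unique; []; _∷_)
open import Data.Nat as ℕ using (ℕ; zero; suc; _≤_; z≤n; s≤s)
import Data.Nat.Properties as ℕₚ
open import Data.Nat.ListAction using (sum)
open import Data.Nat.Solver using (module +-*-Solver)
open import Data.Product using (∃; _×_; _,_; proj₁; proj₂)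
open import Data.Sum using (_⊎_; inj₁; inj₂)
open import Data.Vec as Vec using ([]; _∷_)
open import Data.Vec.Properties using (≡-dec)
open import Level using (0ℓ)
open import Algebra.Bundles using (CommutativeRing)
open import Relation.Binary.Definitions using (DecidableEquality)
open import Relation.Binary.PropositionalEquality
open import Relation.Nullary using (¬_; yes; no; does)
open import Relation.Nullary.Decidable using (dec-true; dec-false)

infixr 5 _∙_
_∙_ : {A : Set} {x y z : A} → x ≡ y → y ≡ z → x ≡ z
_∙_ = trans

module Sums where
  open import Data.Nat using (_+_; _*_)
  open ℕₚ
  open +-*-Solver using (solve; _:+_; _:=_)

  infix 8 [_]*_
  [_]*_ : Bool → ℕ → ℕ
  [ b ]* n = if b then n else 0

  Σ : {A : Set} → List A → (A → ℕ) → ℕ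
  Σ xs f = sum (map f xs)

  []*-∧ : ∀ a b n → [ a ∧ b ]* n ≡ [ a ]* [ b ]* n
  []*-∧ true b n = refl
  []*-∧ false b n = refl

  []*-not : ∀ b n → [ b ]* n + [ not b ]* n ≡ n
  []*-not true n = +-identityʳ n
  []*-not false n = refl

  []*-*1 : ∀ b n → [ b ]* n ≡ [ b ]* 1 * n
  []*-*1 true n = sym (*-identityˡ n)
  []*-*1 false n = refl

  module _ {A : Set} where
    Σ-cong : (xs : List A) {f g : A → ℕ} → (∀ x → f x ≡ g x) → Σ xs f ≡ Σ xs g
    Σ-cong [] e = refl
    Σ-cong (x ∷ xs) e = cong₂ _+_ (e x) (Σ-cong xs e)

    Σ-+ : (xs : List A) (f g : A → ℕ) → Σ xs (λ x → f x + g x) ≡ Σ xs f + Σ xs g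
    Σ-+ [] f g = refl
    Σ-+ (x ∷ xs) f g rewrite Σ-+ xs f g =
      solve 4 (λ a b c d → (a :+ b) :+ (c :+ d) := (a :+ c) :+ (b :+ d)) refl (f x) (g x) (Σ xs f) (Σ xs g)

    Σ-*ˡ : (xs : List A) (c : ℕ) (f : A → ℕ) → Σ xs (λ x → c * f x) ≡ c * Σ xs f
    Σ-*ˡ [] c f = sym (*-zeroʳ c)
    Σ-*ˡ (x ∷ xs) c f rewrite Σ-*ˡ xs c f = sym (*-distribˡ-+ c (f x) _)

    Σ-const : (xs : List A) (c : ℕ) → Σ xs (λ _ → c) ≡ length xs * c
    Σ-const [] c = refl
    Σ-const (x ∷ xs) c rewrite Σ-const xs c = refl

    Σ-zero : (xs : List A) (f : A → ℕ) → (∀ x → f x ≡ 0) → Σ xs f ≡ 0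
    Σ-zero xs f e = Σ-cong xs e ∙ Σ-const xs 0 ∙ *-zeroʳ (length xs)

    Σ-++ : (xs ys : List A) (f : A → ℕ) → Σ (xs ++ ys) f ≡ Σ xs f + Σ ys f
    Σ-++ [] ys f = refl
    Σ-++ (x ∷ xs) ys f rewrite Σ-++ xs ys f = sym (+-assoc (f x) _ _)

    Σ-[]* : (xs : List A) (b : Bool) (f : A → ℕ) → Σ xs (λ x → [ b ]* f x) ≡ [ b ]* Σ xs f
    Σ-[]* xs true f = refl
    Σ-[]* xs false f = Σ-zero xs _ (λ _ → refl)

    Σ-filterᵇ : (xs : List A) (p : A → Bool) (f : A → ℕ) →
                Σ (filterᵇ p xs) f ≡ Σ xs (λ x → [ p x ]* f x)
    Σ-filterᵇ [] p f = refl
    Σ-filterᵇ (x ∷ xs) p f with p x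
    ... | true = cong (f x +_) (Σ-filterᵇ xs p f)
    ... | false = Σ-filterᵇ xs p f

    Σ-mono-≤ : (xs : List A) {f g : A → ℕ} → (∀ x → f x ≤ g x) → Σ xs f ≤ Σ xs g
    Σ-mono-≤ [] e = z≤n
    Σ-mono-≤ (x ∷ xs) e = +-mono-≤ (e x) (Σ-mono-≤ xs e)

    module _ (_≟_ : DecidableEquality A) where
      Σ-δ-∉ : (xs : List A) (z : A) (g : A → ℕ) → z ∉ xs →
              Σ xs (λ y → [ does (z ≟ y) ]* g y) ≡ 0
      Σ-δ-∉ [] z g z∉ = refl
      Σ-δ-∉ (y ∷ ys) z g z∉ with z ≟ y
      ... | yes e = ⊥-elim (z∉ (here e))
      ... | no _ = Σ-δ-∉ ys z g (λ m → z∉ (there m))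

      Σ-δ : (xs : List A) → Unique xs → (z : A) → z ∈ xs → (g : A → ℕ) →
            Σ xs (λ y → [ does (z ≟ y) ]* g y) ≡ g z
      Σ-δ (y ∷ ys) (z≢ys ∷ u) z z∈ g with z ≟ y
      ... | yes refl = cong (g z +_) (Σ-δ-∉ ys z g (All¬⇒∉ z≢ys)) ∙ +-identityʳ _
        where
        All¬⇒∉ : ∀ {ys} → All (λ w → ¬ z ≡ w) ys → z ∉ ys
        All¬⇒∉ (p ∷ ps) (here e) = p e
        All¬⇒∉ (p ∷ ps) (there m) = All¬⇒∉ ps m
      ... | no z≢y with z∈
      ...   | here e = ⊥-elim (z≢y e)
      ...   | there m = Σ-δ ys u z m g

  module _ {A B : Set} where
    Σ-map : (xs : List A) (h : A → B) (f : B → ℕ) → Σ (map h xs) f ≡ Σ xs (λ x → f (h x))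
    Σ-map [] h f = refl
    Σ-map (x ∷ xs) h f = cong (f (h x) +_) (Σ-map xs h f)

    Σ-concatMap : (xs : List A) (g : A → List B) (f : B → ℕ) →
                  Σ (concatMap g xs) f ≡ Σ xs (λ x → Σ (g x) f)
    Σ-concatMap [] g f = refl
    Σ-concatMap (x ∷ xs) g f = Σ-++ (g x) (concatMap g xs) f ∙ cong (Σ (g x) f +_) (Σ-concatMap xs g f)

    Σ-comm : (xs : List A) (ys : List B) (f : A → B → ℕ) →
             Σ xs (λ x → Σ ys (λ y → f x y)) ≡ Σ ys (λ y → Σ xs (λ x → f x y))
    Σ-comm [] ys f = sym (Σ-zero ys _ (λ _ → refl))
    Σ-comm (x ∷ xs) ys f = cong (Σ ys (f x) +_) (Σ-comm xs ys f) ∙ sym (Σ-+ ys (f x) _)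

open Sums

module _ {A : Set} (p : A → Bool) where
  any≡true⁻ : (xs : List A) → any p xs ≡ true → ∃ λ x → x ∈ xs × p x ≡ true
  any≡true⁻ (x ∷ xs) e with p x in eq
  ... | true = x , here refl , eq
  ... | false with any≡true⁻ xs e
  ...   | y , m , e′ = y , there m , e′

  any≡true⁺ : {xs : List A} {x : A} → x ∈ xs → p x ≡ true → any p xs ≡ true
  any≡true⁺ {y ∷ xs} (here refl) e rewrite e = refl
  any≡true⁺ {y ∷ xs} (there m) e with p y
  ... | true = refl
  ... | false = any≡true⁺ m e

  all≡true⁺ : (xs : List A) → (∀ x → p x ≡ true) → all p xs ≡ true
  all≡true⁺ [] e = refl
  all≡true⁺ (x ∷ xs) e rewrite e x = all≡true⁺ xs e

  all≡false⁺ : {xs : List A} {x : A} → x ∈ xs → p x ≡ false → all p xs ≡ false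
  all≡false⁺ {y ∷ xs} (here refl) e rewrite e = refl
  all≡false⁺ {y ∷ xs} (there m) e with p y
  ... | true = all≡false⁺ m e
  ... | false = refl

Bool-ext : ∀ {a b : Bool} → (a ≡ true → b ≡ true) → (b ≡ true → a ≡ true) → a ≡ b
Bool-ext {true} {true} f g = refl
Bool-ext {true} {false} f g = sym (f refl)
Bool-ext {false} {true} f g = g refl
Bool-ext {false} {false} f g = refl

module FieldFacts (F : FiniteField) where
  open FiniteField F
  open Geometry F

  commutativeRing : CommutativeRing 0ℓ 0ℓ
  commutativeRing = record { isCommutativeRing = isCommutativeRing }
  open CommutativeRing commutativeRing public
    using ( +-assoc; +-comm; +-identityˡ; +-identityʳ; -‿inverseˡ; -‿inverseʳ
          ; *-assoc; *-comm; *-identityˡ; *-identityʳ; distribˡ; distribʳ; zeroˡ; zeroʳ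
          ; commutativeSemiring )
  open import Algebra.Properties.Ring (CommutativeRing.ring commutativeRing) public
    using (+-inverseˡ-unique; -0#≈0#; -‿+-comm; -‿distribʳ-*; -‿injective; -1*x≈-x)

  q : ℕ
  q = order

  ==-⇔ : ∀ {x y u v : Carrier} → (x ≡ y → u ≡ v) → (u ≡ v → x ≡ y) → (x == y) ≡ (u == v)
  ==-⇔ {x} {y} {u} {v} f g = does-⇔ (mk⇔ f g) (x ≟ y) (u ≟ v)
    where open import Relation.Nullary.Decidable using (does-⇔)
          open import Function.Bundles using (mk⇔)

  ==-true : ∀ {x y} → x ≡ y → (x == y) ≡ true
  ==-true {x} {y} = dec-true (x ≟ y)

  ==-false : ∀ {x y} → ¬ x ≡ y → (x == y) ≡ false
  ==-false {x} {y} = dec-false (x ≟ y)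

  ==-sound : ∀ {x y} → (x == y) ≡ true → x ≡ y
  ==-sound {x} {y} e with x ≟ y
  ... | yes x≡y = x≡y

  1≢0 : ¬ (1# ≡ 0#)
  1≢0 e = 0≢1 (sym e)

  inverseˡ : ∀ x → ¬ x ≡ 0# → x ⁻¹ * x ≡ 1#
  inverseˡ x x≢0 = *-comm (x ⁻¹) x ∙ inverseʳ x x≢0

  ⁻¹-≢0 : ∀ x → ¬ x ≡ 0# → ¬ (x ⁻¹ ≡ 0#)
  ⁻¹-≢0 x x≢0 e = 0≢1 (sym (zeroʳ x) ∙ cong (x *_) (sym e) ∙ inverseʳ x x≢0)

  ⁻¹*-cancel : ∀ a x → ¬ a ≡ 0# → a ⁻¹ * (a * x) ≡ x
  ⁻¹*-cancel a x a≢0 = sym (*-assoc (a ⁻¹) a x) ∙ cong (_* x) (inverseˡ a a≢0) ∙ *-identityˡ x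

  *⁻¹-cancel : ∀ a x → ¬ a ≡ 0# → a * (a ⁻¹ * x) ≡ x
  *⁻¹-cancel a x a≢0 = sym (*-assoc a (a ⁻¹) x) ∙ cong (_* x) (inverseʳ a a≢0) ∙ *-identityˡ x

  x*y≡0⇒y≡0 : ∀ a x → ¬ a ≡ 0# → a * x ≡ 0# → x ≡ 0#
  x*y≡0⇒y≡0 a x a≢0 e = sym (⁻¹*-cancel a x a≢0) ∙ cong (a ⁻¹ *_) e ∙ zeroʳ (a ⁻¹)

  ΣF : (Carrier → ℕ) → ℕ
  ΣF f = Σ elements f

  ΣF-δ : ∀ z (g : Carrier → ℕ) → ΣF (λ y → [ z == y ]* g y) ≡ g z
  ΣF-δ z g = Σ-δ _≟_ elements elements-unique z (elements-complete z) g

  ΣF-const : ∀ c → ΣF (λ _ → c) ≡ q ℕ.* c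
  ΣF-const c = Σ-const elements c

  ΣF-split : ∀ y (h : Carrier → ℕ) → ΣF h ≡ h y ℕ.+ ΣF (λ x → [ not (y == x) ]* h x)
  ΣF-split y h = Σ-cong elements split ∙ Σ-+ elements _ _
                ∙ cong (ℕ._+ ΣF (λ x → [ not (y == x) ]* h x)) (ΣF-δ y h)
    where
    split : ∀ x → h x ≡ [ y == x ]* h x ℕ.+ [ not (y == x) ]* h x
    split x = sym ([]*-not (y == x) (h x))

  ΣF-bijection : (σ τ : Carrier → Carrier) → (∀ y → σ (τ y) ≡ y) → (∀ x → τ (σ x) ≡ x) →
                 (g : Carrier → ℕ) → ΣF (λ x → g (σ x)) ≡ ΣF g
  ΣF-bijection σ τ στ τσ g =
      Σ-cong elements (λ x → sym (ΣF-δ (σ x) g))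
    ∙ Σ-comm elements elements (λ x y → [ σ x == y ]* g y)
    ∙ Σ-cong elements (λ y → Σ-cong elements (λ x → cong (λ b → [ b ]* g y) (σx≡y⇔τy≡x x y))
                           ∙ ΣF-δ (τ y) (λ _ → g y))
    where
    σx≡y⇔τy≡x : ∀ x y → (σ x == y) ≡ (τ y == x)
    σx≡y⇔τy≡x x y = ==-⇔ (λ e → sym (cong τ e) ∙ τσ x) (λ e → sym (cong σ e) ∙ στ y)

  q≡1+#nonzero : q ≡ suc (ΣF (λ x → [ not (0# == x) ]* 1))
  q≡1+#nonzero = sym (ℕₚ.*-identityʳ q) ∙ sym (ΣF-const 1) ∙ ΣF-split 0# (λ _ → 1)

  q≥2 : 2 ≤ q
  q≥2 = subst (2 ≤_) (sym q≡1+#nonzero)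
          (s≤s (subst (_≤ ΣF (λ x → [ not (0# == x) ]* 1)) (ΣF-δ 1# (λ _ → 1)) (Σ-mono-≤ elements at1≤nonzero)))
    where
    at1≤nonzero : ∀ x → [ 1# == x ]* 1 ≤ [ not (0# == x) ]* 1
    at1≤nonzero x with 0# ≟ x | 1# ≟ x
    ... | yes refl | yes e = ⊥-elim (1≢0 e)
    ... | yes _ | no _ = z≤n
    ... | no _ | yes _ = ℕₚ.≤-refl
    ... | no _ | no _ = z≤n

  module _ (f : Carrier → Carrier) where
    #preimages : Carrier → ℕ
    #preimages z = ΣF (λ x → [ f x == z ]* 1)

    Σ#preimages : ΣF #preimages ≡ q
    Σ#preimages = Σ-comm elements elements _ ∙ Σ-cong elements (λ x → ΣF-δ (f x) (λ _ → 1))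
                ∙ ΣF-const 1 ∙ ℕₚ.*-identityʳ q

    #preimages-none : ∀ z → any (λ x → f x == z) elements ≡ false → #preimages z ≡ 0
    #preimages-none z none = Σ-zero elements _ miss
      where
      miss : ∀ x → [ f x == z ]* 1 ≡ 0
      miss x with f x == z in fx≡z
      ... | false = refl
      ... | true with () ← sym (any≡true⁺ (λ x → f x == z) (elements-complete x) fx≡z) ∙ none

    injective⇒#preimages≤1 : (∀ x y → f x ≡ f y → x ≡ y) → ∀ z → #preimages z ≤ 1
    injective⇒#preimages≤1 f-inj z with any (λ x → f x == z) elements in some
    ... | false = ℕₚ.≤-trans (ℕₚ.≤-reflexive (#preimages-none z some)) z≤n
    ... | true with any≡true⁻ (λ x → f x == z) elements some
    ...   | x₀ , _ , fx₀≡z = ℕₚ.≤-reflexive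
            (Σ-cong elements (λ x → cong (λ b → [ b ]* 1)
               (==-⇔ (λ e → f-inj x₀ x (==-sound fx₀≡z ∙ sym e)) (λ e → cong f (sym e) ∙ ==-sound fx₀≡z)))
             ∙ ΣF-δ x₀ (λ _ → 1))

  injective⇒surjective : (f : Carrier → Carrier) → (∀ x y → f x ≡ f y → x ≡ y) →
                         ∀ y → ∃ λ x → f x ≡ y
  injective⇒surjective f f-inj y with any (λ x → f x == y) elements in hit
  ... | true with any≡true⁻ (λ x → f x == y) elements hit
  ...   | x , _ , e = x , ==-sound e
  injective⇒surjective f f-inj y | false = ⊥-elim (ℕₚ.<-irrefl refl q<q)
    where
    others : (Carrier → ℕ) → ℕ
    others h = ΣF (λ z → [ not (y == z) ]* h z)
    bound : ∀ z → [ not (y == z) ]* #preimages f z ≤ [ not (y == z) ]* 1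
    bound z with not (y == z)
    ... | true = injective⇒#preimages≤1 f f-inj z
    ... | false = z≤n
    q<q : q ℕ.< q
    q<q = begin-strict
      q                                     ≡⟨ sym (Σ#preimages f) ⟩
      ΣF (#preimages f)                     ≡⟨ ΣF-split y (#preimages f) ⟩
      #preimages f y ℕ.+ others (#preimages f)
                                            ≡⟨ cong (ℕ._+ others (#preimages f)) (#preimages-none f y hit) ⟩
      others (#preimages f)                 ≤⟨ Σ-mono-≤ elements bound ⟩
      others (λ _ → 1)                      <⟨ ℕₚ.n<1+n _ ⟩
      suc (others (λ _ → 1))                ≡⟨ sym (ΣF-split y (λ _ → 1)) ⟩
      ΣF (λ _ → 1)                          ≡⟨ ΣF-const 1 ∙ ℕₚ.*-identityʳ q ⟩
      q                                     ∎
      where open ℕₚ.≤-Reasoning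

  ΣV : (n : ℕ) → (V n → ℕ) → ℕ
  ΣV n f = Σ (allVecs n) f

  ΣV-suc : ∀ n (f : V (suc n) → ℕ) → ΣV (suc n) f ≡ ΣF (λ x → ΣV n (λ w → f (x ∷ w)))
  ΣV-suc n f = Σ-concatMap elements (λ x → map (x ∷_) (allVecs n)) f
             ∙ Σ-cong elements (λ x → Σ-map (allVecs n) (x ∷_) f)

  ΣV-count : ∀ n → ΣV n (λ _ → 1) ≡ q ℕ.^ n
  ΣV-count zero = refl
  ΣV-count (suc n) = ΣV-suc n _ ∙ Σ-cong elements (λ _ → ΣV-count n) ∙ ΣF-const _

  ∈-allVecs : ∀ {n} (v : V n) → v ∈ allVecs n
  ∈-allVecs [] = here refl
  ∈-allVecs {suc n} (x ∷ v) =
    ∈-concatMap⁺ (λ y → map (y ∷_) (allVecs n)) (lose (elements-complete x) (∈-map⁺ (x ∷_) (∈-allVecs v)))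

  ==ᵥ-true : ∀ {n} {u v : V n} → u ≡ v → (u ==ᵥ v) ≡ true
  ==ᵥ-true {u = []} refl = refl
  ==ᵥ-true {u = x ∷ u} refl rewrite ==-true {x} {x} refl = ==ᵥ-true {u = u} refl

  ==ᵥ-sound : ∀ {n} {u v : V n} → (u ==ᵥ v) ≡ true → u ≡ v
  ==ᵥ-sound {u = []} {[]} e = refl
  ==ᵥ-sound {u = x ∷ u} {y ∷ v} e with x ≟ y
  ... | yes refl = cong (x ∷_) (==ᵥ-sound e)

  ==ᵥ-⇔ : ∀ {n m} {x y : V n} {u v : V m} → (x ≡ y → u ≡ v) → (u ≡ v → x ≡ y) → (x ==ᵥ y) ≡ (u ==ᵥ v)
  ==ᵥ-⇔ f g = Bool-ext (λ e → ==ᵥ-true (f (==ᵥ-sound e))) (λ e → ==ᵥ-true (g (==ᵥ-sound e)))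

  ΣV-δ : ∀ {n} (u : V n) (g : V n → ℕ) → ΣV n (λ v → [ u ==ᵥ v ]* g v) ≡ g u
  ΣV-δ [] g = ℕₚ.+-identityʳ (g [])
  ΣV-δ {suc n} (u₀ ∷ u) g =
      ΣV-suc n _
    ∙ Σ-cong elements (λ x → Σ-cong (allVecs n) (λ w → []*-∧ (u₀ == x) (u ==ᵥ w) (g (x ∷ w)))
                           ∙ Σ-[]* (allVecs n) (u₀ == x) _
                           ∙ cong ([ u₀ == x ]*_) (ΣV-δ u (λ w → g (x ∷ w))))
    ∙ ΣF-δ u₀ (λ x → g (x ∷ u))

  ΣV-scale : ∀ {n} (a : Carrier) → ¬ a ≡ 0# → (f : V n → ℕ) → ΣV n (λ v → f (a · v)) ≡ ΣV n f
  ΣV-scale {zero} a a≢0 f = refl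
  ΣV-scale {suc n} a a≢0 f =
      ΣV-suc n _
    ∙ Σ-cong elements (λ x → ΣV-scale a a≢0 (λ w → f ((a * x) ∷ w)))
    ∙ ΣF-bijection (a *_) (a ⁻¹ *_) (λ y → *⁻¹-cancel a y a≢0) (λ x → ⁻¹*-cancel a x a≢0)
                   (λ y → ΣV n (λ w → f (y ∷ w)))
    ∙ sym (ΣV-suc n f)

module VectorAlgebra (F : FiniteField) where
  open FiniteField F
  open Geometry F
  open FieldFacts F
  open import Algebra.Solver.Ring.NaturalCoefficients.Default commutativeSemiring
    using (solve; _:+_; _:=_)

  ·-zeroˡ : ∀ {n} (v : V n) → 0# · v ≡ zeroᵥ
  ·-zeroˡ [] = refl
  ·-zeroˡ (x ∷ v) = cong₂ _∷_ (zeroˡ x) (·-zeroˡ v)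

  ·-zeroʳ : ∀ {n} a → a · zeroᵥ {n} ≡ zeroᵥ
  ·-zeroʳ {zero} a = refl
  ·-zeroʳ {suc n} a = cong₂ _∷_ (zeroʳ a) (·-zeroʳ a)

  ·-identityˡ : ∀ {n} (v : V n) → 1# · v ≡ v
  ·-identityˡ [] = refl
  ·-identityˡ (x ∷ v) = cong₂ _∷_ (*-identityˡ x) (·-identityˡ v)

  ·-assoc : ∀ {n} a b (v : V n) → a · (b · v) ≡ (a * b) · v
  ·-assoc a b [] = refl
  ·-assoc a b (x ∷ v) = cong₂ _∷_ (sym (*-assoc a b x)) (·-assoc a b v)

  ·-distribʳ : ∀ {n} a b (v : V n) → (a + b) · v ≡ (a · v) +ᵥ (b · v)
  ·-distribʳ a b [] = refl
  ·-distribʳ a b (x ∷ v) = cong₂ _∷_ (distribʳ x a b) (·-distribʳ a b v)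

  ·-distribˡ : ∀ {n} a (u v : V n) → a · (u +ᵥ v) ≡ (a · u) +ᵥ (a · v)
  ·-distribˡ a [] [] = refl
  ·-distribˡ a (x ∷ u) (y ∷ v) = cong₂ _∷_ (distribˡ a x y) (·-distribˡ a u v)

  +ᵥ-identityˡ : ∀ {n} (v : V n) → zeroᵥ +ᵥ v ≡ v
  +ᵥ-identityˡ [] = refl
  +ᵥ-identityˡ (x ∷ v) = cong₂ _∷_ (+-identityˡ x) (+ᵥ-identityˡ v)

  +ᵥ-interchange : ∀ {n} (a b c d : V n) → (a +ᵥ b) +ᵥ (c +ᵥ d) ≡ (a +ᵥ c) +ᵥ (b +ᵥ d)
  +ᵥ-interchange [] [] [] [] = refl
  +ᵥ-interchange (a ∷ as) (b ∷ bs) (c ∷ cs) (d ∷ ds) =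
    cong₂ _∷_ (solve 4 (λ a b c d → (a :+ b) :+ (c :+ d) := (a :+ c) :+ (b :+ d)) refl a b c d)
              (+ᵥ-interchange as bs cs ds)

  lincomb-zero : ∀ {N d} (b : Fin d → V N) → lincomb zeroᵥ b ≡ zeroᵥ
  lincomb-zero {d = zero} b = refl
  lincomb-zero {d = suc d} b =
    cong₂ _+ᵥ_ (·-zeroˡ (b zero)) (lincomb-zero (λ i → b (suc i))) ∙ +ᵥ-identityˡ zeroᵥ

  lincomb-+ : ∀ {N d} (c c′ : V d) (b : Fin d → V N) →
              lincomb (c +ᵥ c′) b ≡ lincomb c b +ᵥ lincomb c′ b
  lincomb-+ [] [] b = sym (+ᵥ-identityˡ zeroᵥ)
  lincomb-+ (x ∷ c) (y ∷ c′) b =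
    cong₂ _+ᵥ_ (·-distribʳ x y (b zero)) (lincomb-+ c c′ (λ i → b (suc i))) ∙ +ᵥ-interchange _ _ _ _

  lincomb-· : ∀ {N d} a (c : V d) (b : Fin d → V N) → lincomb (a · c) b ≡ a · lincomb c b
  lincomb-· a [] b = sym (·-zeroʳ a)
  lincomb-· a (x ∷ c) b =
    cong₂ _+ᵥ_ (sym (·-assoc a x (b zero))) (lincomb-· a c (λ i → b (suc i))) ∙ sym (·-distribˡ a _ _)

  y+-1*y≡0 : ∀ y → y + (- 1#) * y ≡ 0#
  y+-1*y≡0 y = cong (y +_) (-1*x≈-x y) ∙ -‿inverseʳ y

  u-v≡0⇒u≡v : ∀ {n} (u v : V n) → u +ᵥ ((- 1#) · v) ≡ zeroᵥ → u ≡ v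
  u-v≡0⇒u≡v [] [] e = refl
  u-v≡0⇒u≡v (x ∷ u) (y ∷ v) e =
    cong₂ _∷_ (+-inverseˡ-unique x _ (cong Vec.head e) ∙ sym (+-inverseˡ-unique y _ (y+-1*y≡0 y)))
              (u-v≡0⇒u≡v u v (cong Vec.tail e))

  v-v≡0 : ∀ {n} (v : V n) → v +ᵥ ((- 1#) · v) ≡ zeroᵥ
  v-v≡0 [] = refl
  v-v≡0 (x ∷ v) = cong₂ _∷_ (y+-1*y≡0 x) (v-v≡0 v)

  lincomb-injective : ∀ {N d} (π : Subspace N d) (c c′ : V d) →
                      lincomb c (basis π) ≡ lincomb c′ (basis π) → c ≡ c′
  lincomb-injective π c c′ e = u-v≡0⇒u≡v c c′ (independent π _
      (lincomb-+ c ((- 1#) · c′) (basis π)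
     ∙ cong (_+ᵥ lincomb ((- 1#) · c′) (basis π)) e
     ∙ cong (lincomb c′ (basis π) +ᵥ_) (lincomb-· (- 1#) c′ (basis π))
     ∙ v-v≡0 _))

  unit : ∀ {d} → Fin d → V d
  unit zero = 1# ∷ zeroᵥ
  unit (suc i) = 0# ∷ unit i

  lincomb-0∷ : ∀ {N d} (c : V d) (b : Fin d → V N) → lincomb c (λ i → 0# ∷ b i) ≡ 0# ∷ lincomb c b
  lincomb-0∷ [] b = refl
  lincomb-0∷ (x ∷ c) b rewrite lincomb-0∷ c (λ i → b (suc i)) =
    cong (_∷ ((x · b zero) +ᵥ lincomb c (λ i → b (suc i)))) (cong (_+ 0#) (zeroʳ x) ∙ +-identityˡ 0#)

  lincomb-unit : ∀ {N} (c : V N) → lincomb c unit ≡ c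
  lincomb-unit [] = refl
  lincomb-unit (x ∷ c) rewrite lincomb-0∷ c unit | lincomb-unit c =
    cong₂ _∷_ (cong (_+ 0#) (*-identityʳ x) ∙ +-identityʳ x) (cong (_+ᵥ c) (·-zeroʳ x) ∙ +ᵥ-identityˡ c)

  wholeSpace : ∀ N → Subspace N N
  wholeSpace N = record { basis = unit ; independent = λ c e → sym (lincomb-unit c) ∙ e }

  allZero⊎someNonzero : ∀ {d} (a : Fin d → Carrier) → (∀ i → a i ≡ 0#) ⊎ (∃ λ i → ¬ a i ≡ 0#)
  allZero⊎someNonzero {zero} a = inj₁ (λ ())
  allZero⊎someNonzero {suc d} a with a zero ≟ 0# | allZero⊎someNonzero (λ i → a (suc i))
  ... | no a₀≢0 | _ = inj₂ (zero , a₀≢0)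
  ... | yes _ | inj₂ (i , aᵢ≢0) = inj₂ (suc i , aᵢ≢0)
  ... | yes a₀≡0 | inj₁ rest≡0 = inj₁ (λ { zero → a₀≡0 ; (suc i) → rest≡0 i })

module PointCounting (F : FiniteField) where
  open FiniteField F using (Carrier; 0#; 1#; _⁻¹; 0≢1; _≟_; _==_; elements)
  open Geometry F
  open FieldFacts F
  open VectorAlgebra F
  open import Data.Nat using (_+_; _*_)
  open +-*-Solver using (solve; _:+_; _:*_; _:=_)

  ScaleInvariant : ∀ {n} → (V n → Bool) → Set
  ScaleInvariant {n} S = ∀ (a : Carrier) (v : V n) → ¬ a ≡ 0# → S (a · v) ≡ S v

  #vectors : ∀ {n} → (V n → Bool) → ℕ
  #vectors {n} S = ΣV n (λ v → [ S v ]* 1)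

  #points : ∀ {n} → (V n → Bool) → ℕ
  #points {n} S = Σ (points n) (λ v → [ S v ]* 1)

  Σnonzero+1 : ∀ K → ΣF (λ x → [ not (0# == x) ]* K) + K ≡ q * K
  Σnonzero+1 K = ℕₚ.+-comm _ K ∙ sym (ΣF-split 0# (λ _ → K)) ∙ ΣF-const K

  module _ {n : ℕ} (S : V (suc n) → Bool) where
    headZero headOne : V n → Bool
    headZero w = S (0# ∷ w)
    headOne w = S (1# ∷ w)

    headZero-scale : ScaleInvariant S → ScaleInvariant headZero
    headZero-scale S-inv a w a≢0 = cong (λ z → S (z ∷ (a · w))) (sym (zeroʳ a)) ∙ S-inv a (0# ∷ w) a≢0

    #vectors-by-head : ScaleInvariant S →
                       #vectors S ≡ #vectors headZero + ΣF (λ x → [ not (0# == x) ]* #vectors headOne)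
    #vectors-by-head S-inv =
      ΣV-suc n _ ∙ ΣF-split 0# row ∙ cong (#vectors headZero +_) (Σ-cong elements nonzero-rows)
      where
      row : Carrier → ℕ
      row x = ΣV n (λ w → [ S (x ∷ w) ]* 1)
      row-nonzero : ∀ x → ¬ x ≡ 0# → row x ≡ #vectors headOne
      row-nonzero x x≢0 =
          Σ-cong (allVecs n) (λ w → cong (λ b → [ b ]* 1)
            (sym (S-inv (x ⁻¹) (x ∷ w) (⁻¹-≢0 x x≢0)) ∙ cong (λ z → S (z ∷ ((x ⁻¹) · w))) (inverseˡ x x≢0)))
        ∙ ΣV-scale (x ⁻¹) (⁻¹-≢0 x x≢0) (λ w → [ headOne w ]* 1)
      nonzero-rows : ∀ x → [ not (0# == x) ]* row x ≡ [ not (0# == x) ]* #vectors headOne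
      nonzero-rows x with 0# ≟ x
      ... | yes _ = refl
      ... | no 0≢x = row-nonzero x (λ e → 0≢x (sym e))

    #points-by-head : #points S ≡ #points headZero + #vectors headOne
    #points-by-head = Σ-filterᵇ (allVecs (suc n)) normalised _
                    ∙ ΣV-suc n _
                    ∙ ΣF-split 0# _
                    ∙ cong₂ _+_ leading-zero (Σ-cong elements leading-nonzero ∙ ΣF-δ 1# (λ _ → #vectors headOne))
      where
      leading-zero : ΣV n (λ w → [ normalised (0# ∷ w) ]* [ S (0# ∷ w) ]* 1) ≡ #points headZero
      leading-zero rewrite ==-true {0#} {0#} refl = sym (Σ-filterᵇ (allVecs n) normalised _)
      leading-nonzero : ∀ x → [ not (0# == x) ]* ΣV n (λ w → [ normalised (x ∷ w) ]* [ S (x ∷ w) ]* 1)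
                            ≡ [ 1# == x ]* #vectors headOne
      leading-nonzero x with 0# ≟ x | x ≟ 0#
      ... | yes refl | _ rewrite ==-false {1#} {0#} 1≢0 = refl
      ... | no 0≢x | yes x≡0 = ⊥-elim (0≢x (sym x≡0))
      ... | no _ | no _ with x ≟ 1# | 1# ≟ x
      ...   | yes refl | yes _ = Σ-[]* (allVecs n) true _
      ...   | yes refl | no 1≢1 = ⊥-elim (1≢1 refl)
      ...   | no x≢1 | yes 1≡x = ⊥-elim (x≢1 (sym 1≡x))
      ...   | no _ | no _ = Σ-[]* (allVecs n) false (λ w → [ S (x ∷ w) ]* 1)

  -- That is, #vectors S = (q − 1)·#points S + [0 ∈ S]: each point contributes its q − 1 nonzero multiples.
  #vectors+#points : ∀ n (S : V n → Bool) → ScaleInvariant S →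
                     #vectors S + #points S ≡ q * #points S + [ S zeroᵥ ]* 1
  #vectors+#points zero S S-inv =
    ℕₚ.+-identityʳ _ ∙ ℕₚ.+-identityʳ _ ∙ cong (_+ [ S [] ]* 1) (sym (ℕₚ.*-zeroʳ q))
  #vectors+#points (suc n) S S-inv = begin
      #vectors S + #points S
    ≡⟨ cong₂ _+_ (#vectors-by-head S S-inv) (#points-by-head S) ⟩
      (#vectors S₀ + nonzero) + (#points S₀ + K)
    ≡⟨ solve 4 (λ a b c d → (a :+ b) :+ (c :+ d) := (a :+ c) :+ (b :+ d))
             refl (#vectors S₀) nonzero (#points S₀) K ⟩
      (#vectors S₀ + #points S₀) + (nonzero + K)
    ≡⟨ cong₂ _+_ (#vectors+#points n S₀ (headZero-scale S S-inv)) (Σnonzero+1 K) ⟩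
      (q * #points S₀ + [ S zeroᵥ ]* 1) + q * K
    ≡⟨ solve 4 (λ Q p s k → (Q :* p :+ s) :+ Q :* k := Q :* (p :+ k) :+ s)
             refl q (#points S₀) ([ S zeroᵥ ]* 1) K ⟩
      q * (#points S₀ + K) + [ S zeroᵥ ]* 1
    ≡⟨ cong (λ z → q * z + [ S zeroᵥ ]* 1) (sym (#points-by-head S)) ⟩
      q * #points S + [ S zeroᵥ ]* 1 ∎
    where
    open ≡-Reasoning
    S₀ = headZero S
    K = #vectors (headOne S)
    nonzero = ΣF (λ x → [ not (0# == x) ]* K)

module Spans (F : FiniteField) where
  open FiniteField F using (Carrier; 0#; _⁻¹)
  open Geometry F
  open FieldFacts F
  open VectorAlgebra F
  open PointCounting F

  Σ-inSpan : ∀ {N d} (π : Subspace N d) (h : V N → ℕ) →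
             ΣV N (λ v → [ inSpan π v ]* h v) ≡ ΣV d (λ c → h (lincomb c (basis π)))
  Σ-inSpan {N} {d} π h =
      Σ-cong (allVecs N) span-as-sum
    ∙ Σ-comm (allVecs N) (allVecs d) (λ v c → [ lincomb c (basis π) ==ᵥ v ]* h v)
    ∙ Σ-cong (allVecs d) (λ c → ΣV-δ (lincomb c (basis π)) h)
    where
    hits : V N → V d → Bool
    hits v c = lincomb c (basis π) ==ᵥ v
    span-as-sum : ∀ v → [ inSpan π v ]* h v ≡ ΣV d (λ c → [ hits v c ]* h v)
    span-as-sum v with inSpan π v in v∈π
    ... | true with any≡true⁻ (hits v) (allVecs d) v∈π
    ...   | c₀ , _ , c₀↦v = sym
              (Σ-cong (allVecs d) (λ c → cong (λ z → [ z ]* h v)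
                 (==ᵥ-⇔ (λ e → lincomb-injective π c₀ c (==ᵥ-sound c₀↦v ∙ sym e))
                        (λ e → cong (λ z → lincomb z (basis π)) (sym e) ∙ ==ᵥ-sound c₀↦v)))
               ∙ ΣV-δ c₀ (λ _ → h v))
    span-as-sum v | false = sym (Σ-zero (allVecs d) _ (λ c → cong (λ z → [ z ]* h v) (miss c)))
      where
      miss : ∀ c → hits v c ≡ false
      miss c with hits v c in c↦v
      ... | false = refl
      ... | true = sym (any≡true⁺ (hits v) (∈-allVecs c) c↦v) ∙ v∈π

  inSpan-zero : ∀ {N d} (π : Subspace N d) → inSpan π zeroᵥ ≡ true
  inSpan-zero {d = d} π =
    any≡true⁺ (λ c → lincomb c (basis π) ==ᵥ zeroᵥ) (∈-allVecs {d} zeroᵥ) (==ᵥ-true (lincomb-zero (basis π)))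

  inSpan-scale : ∀ {N d} (π : Subspace N d) → ScaleInvariant (inSpan π)
  inSpan-scale {N} {d} π a v a≢0 =
    Bool-ext (λ e → sym (cong (inSpan π) a⁻¹a·v≡v) ∙ closed (a ⁻¹) (a · v) e) (closed a v)
    where
    a⁻¹a·v≡v : (a ⁻¹) · (a · v) ≡ v
    a⁻¹a·v≡v = ·-assoc (a ⁻¹) a v ∙ cong (_· v) (inverseˡ a a≢0) ∙ ·-identityˡ v
    closed : ∀ a v → inSpan π v ≡ true → inSpan π (a · v) ≡ true
    closed a v v∈π with any≡true⁻ _ (allVecs d) v∈π
    ... | c₀ , _ , c₀↦v = any≡true⁺ _ (∈-allVecs (a · c₀))
                            (==ᵥ-true (lincomb-· a c₀ (basis π) ∙ cong (a ·_) (==ᵥ-sound c₀↦v)))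

  #points-inSpan : ∀ {N d} (π : Subspace N d) →
                   q ℕ.^ d ℕ.+ #points (inSpan π) ≡ q ℕ.* #points (inSpan π) ℕ.+ 1
  #points-inSpan {N} {d} π =
      cong (ℕ._+ #points (inSpan π)) (sym (Σ-inSpan π (λ _ → 1) ∙ ΣV-count d))
    ∙ #vectors+#points N (inSpan π) (inSpan-scale π)
    ∙ cong (λ b → q ℕ.* #points (inSpan π) ℕ.+ [ b ]* 1) (inSpan-zero π)

module FormProperties (F : FiniteField) where
  open FiniteField F
  open Geometry F
  open FieldFacts F using (zeroˡ)
  open VectorAlgebra F using (·-zeroˡ)

  module _ {N : ℕ} (B : V N → V N → Carrier) where
    Additiveˡ Homogeneousˡ Nondegenerate : Set
    Additiveˡ = ∀ u v x → B (u +ᵥ v) x ≡ B u x + B v x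
    Homogeneousˡ = ∀ a u x → B (a · u) x ≡ a * B u x
    Nondegenerate = ∀ x → normalised x ≡ true → ∃ λ v → ¬ B v x ≡ 0#

    homogeneous⇒zeroˡ : Homogeneousˡ → ∀ x → B zeroᵥ x ≡ 0#
    homogeneous⇒zeroˡ B-· x = cong (λ z → B z x) (sym (·-zeroˡ zeroᵥ)) ∙ B-· 0# zeroᵥ x ∙ zeroˡ _

module FormCounting (F : FiniteField) {N : ℕ} (B : Geometry.V F N → Geometry.V F N → FiniteField.Carrier F)
  (B-+ : FormProperties.Additiveˡ F B) (B-· : FormProperties.Homogeneousˡ F B) where

  open FiniteField F
  open Geometry F
  open FieldFacts F
  open VectorAlgebra F
  open PointCounting F
  open Spans F

  B-zero : ∀ x → B zeroᵥ x ≡ 0#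
  B-zero = FormProperties.homogeneous⇒zeroˡ F B B-·

  B-lincomb-∷ : ∀ {d} y (cs : V d) (b : Fin (suc d) → V N) x →
                B (lincomb (y ∷ cs) b) x ≡ y * B (b zero) x + B (lincomb cs (λ i → b (suc i))) x
  B-lincomb-∷ y cs b x = B-+ _ _ x ∙ cong (_+ B (lincomb cs (λ i → b (suc i))) x) (B-· y (b zero) x)

  B-lincomb-zero : ∀ {d} (b : Fin d → V N) x → (∀ i → B (b i) x ≡ 0#) → ∀ c → B (lincomb c b) x ≡ 0#
  B-lincomb-zero b x b⊥x [] = B-zero x
  B-lincomb-zero b x b⊥x (y ∷ c) =
      B-lincomb-∷ y c b x
    ∙ cong₂ _+_ (cong (y *_) (b⊥x zero) ∙ zeroʳ y) (B-lincomb-zero (λ i → b (suc i)) x (λ i → b⊥x (suc i)) c)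
    ∙ +-identityˡ 0#

  B-lincomb-unit : ∀ {d} (b : Fin d → V N) x i → B (lincomb (unit i) b) x ≡ B (b i) x
  B-lincomb-unit b x zero =
      B-lincomb-∷ 1# zeroᵥ b x
    ∙ cong₂ _+_ (*-identityˡ _) (cong (λ z → B z x) (lincomb-zero (λ i → b (suc i))) ∙ B-zero x)
    ∙ +-identityʳ _
  B-lincomb-unit b x (suc i) =
      B-lincomb-∷ 0# (unit i) b x
    ∙ cong (_+ B (lincomb (unit i) (λ i → b (suc i))) x) (zeroˡ _)
    ∙ +-identityˡ _
    ∙ B-lincomb-unit (λ i → b (suc i)) x i

  #annihilating : ∀ {d} (b : Fin d → V N) x → ℕ
  #annihilating {d} b x = ΣV d (λ c → [ B (lincomb c b) x == 0# ]* 1)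

  #annihilating-all : ∀ {d} (b : Fin d → V N) x → (∀ i → B (b i) x ≡ 0#) → #annihilating b x ≡ q ℕ.^ d
  #annihilating-all {d} b x b⊥x =
    Σ-cong (allVecs d) (λ c → cong (λ z → [ z ]* 1) (==-true (B-lincomb-zero b x b⊥x c))) ∙ ΣV-count d

  unique-root : ∀ a t → ¬ a ≡ 0# → ΣF (λ y → [ (y * a + t) == 0# ]* 1) ≡ 1
  unique-root a t a≢0 =
    Σ-cong elements (λ y → cong (λ z → [ z ]* 1) (==-⇔ root⇒ ⇒root)) ∙ ΣF-δ ((- t) * (a ⁻¹)) (λ _ → 1)
    where
    root⇒ : ∀ {y} → y * a + t ≡ 0# → (- t) * (a ⁻¹) ≡ y
    root⇒ {y} e = sym (sym (*-identityʳ y) ∙ cong (y *_) (sym (inverseʳ a a≢0))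
                     ∙ sym (*-assoc y a (a ⁻¹)) ∙ cong (_* (a ⁻¹)) (+-inverseˡ-unique (y * a) t e))
    ⇒root : ∀ {y} → (- t) * (a ⁻¹) ≡ y → y * a + t ≡ 0#
    ⇒root refl = cong (_+ t) (*-assoc (- t) (a ⁻¹) a ∙ cong ((- t) *_) (inverseˡ a a≢0) ∙ *-identityʳ (- t))
               ∙ -‿inverseˡ t

  -- That is, q^(d−1) solutions: the coefficient of a basis vector with nonzero B-value is determined by the others.
  #annihilating-some : ∀ {d} (b : Fin d → V N) x (i : Fin d) → ¬ B (b i) x ≡ 0# →
                       q ℕ.* #annihilating b x ≡ q ℕ.^ d
  #annihilating-some {suc d} b x i bᵢx≢0 with B (b zero) x ≟ 0#
  ... | no b₀x≢0 = cong (q ℕ.*_)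
        (ΣV-suc d _
       ∙ Σ-cong elements (λ y → Σ-cong (allVecs d) (λ cs → cong (λ z → [ z == 0# ]* 1) (B-lincomb-∷ y cs b x)))
       ∙ Σ-comm elements (allVecs d) _
       ∙ Σ-cong (allVecs d) (λ cs → unique-root _ _ b₀x≢0)
       ∙ ΣV-count d)
  ... | yes b₀x≡0 with i
  ...   | zero = ⊥-elim (bᵢx≢0 b₀x≡0)
  ...   | suc i′ = cong (q ℕ.*_)
          (ΣV-suc d _
         ∙ Σ-cong elements (λ y → Σ-cong (allVecs d) (λ cs → cong (λ z → [ z == 0# ]* 1) (drop-head y cs)))
         ∙ ΣF-const _)
        ∙ cong (q ℕ.*_) (#annihilating-some (λ i → b (suc i)) x i′ bᵢx≢0)
    where
    drop-head : ∀ y cs → B (lincomb (y ∷ cs) b) x ≡ B (lincomb cs (λ i → b (suc i))) x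
    drop-head y cs = B-lincomb-∷ y cs b x
                   ∙ cong (_+ B (lincomb cs (λ i → b (suc i))) x) (cong (y *_) b₀x≡0 ∙ zeroʳ y)
                   ∙ +-identityˡ _

  inPerp-all : ∀ {d} (π : Subspace N d) x → (∀ i → B (basis π i) x ≡ 0#) → inPerp B π x ≡ true
  inPerp-all {d} π x π⊥x = all≡true⁺ _ (allVecs d) (λ c → ==-true (B-lincomb-zero (basis π) x π⊥x c))

  inPerp-some : ∀ {d} (π : Subspace N d) x i → ¬ B (basis π i) x ≡ 0# → inPerp B π x ≡ false
  inPerp-some {d} π x i bᵢx≢0 =
    all≡false⁺ _ (∈-allVecs (unit i)) (==-false (λ e → bᵢx≢0 (sym (B-lincomb-unit (basis π) x i) ∙ e)))

  q*#annihilating : ∀ {d} (π : Subspace N d) x →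
                    q ℕ.* #annihilating (basis π) x ≡ q ℕ.^ d ℕ.* (if inPerp B π x then q else 1)
  q*#annihilating {d} π x with allZero⊎someNonzero (λ i → B (basis π i) x)
  ... | inj₁ π⊥x rewrite inPerp-all π x π⊥x | #annihilating-all (basis π) x π⊥x = ℕₚ.*-comm q _
  ... | inj₂ (i , bᵢx≢0) rewrite inPerp-some π x i bᵢx≢0 =
    #annihilating-some (basis π) x i bᵢx≢0 ∙ sym (ℕₚ.*-identityʳ _)

  inSpanPerpTo : ∀ {d} (π : Subspace N d) x → V N → Bool
  inSpanPerpTo π x v = inSpan π v ∧ (B v x == 0#)

  inSpanPerpTo-scale : ∀ {d} (π : Subspace N d) x → ScaleInvariant (inSpanPerpTo π x)
  inSpanPerpTo-scale π x a v a≢0 =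
    cong₂ _∧_ (inSpan-scale π a v a≢0)
              (==-⇔ (λ e → x*y≡0⇒y≡0 a _ a≢0 (sym (B-· a v x) ∙ e)) (λ e → B-· a v x ∙ cong (a *_) e ∙ zeroʳ a))

  #points-inSpanPerpTo : ∀ {d} (π : Subspace N d) x →
    #annihilating (basis π) x ℕ.+ #points (inSpanPerpTo π x) ≡ q ℕ.* #points (inSpanPerpTo π x) ℕ.+ 1
  #points-inSpanPerpTo π x =
      cong (ℕ._+ #points (inSpanPerpTo π x)) (sym #vectors≡#annihilating)
    ∙ #vectors+#points N (inSpanPerpTo π x) (inSpanPerpTo-scale π x)
    ∙ cong (λ b → q ℕ.* #points (inSpanPerpTo π x) ℕ.+ [ b ]* 1)
           (cong₂ _∧_ (inSpan-zero π) (==-true (B-zero x)))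
    where
    #vectors≡#annihilating : #vectors (inSpanPerpTo π x) ≡ #annihilating (basis π) x
    #vectors≡#annihilating = Σ-cong (allVecs N) (λ v → []*-∧ (inSpan π v) _ 1)
                           ∙ Σ-inSpan π (λ v → [ B v x == 0# ]* 1)

module Arithmetic where
  open import Data.Nat using (_+_; _*_; >-nonZero)
  open import Data.Nat.Tactic.RingSolver using (solve-∀)
  open +-*-Solver using (solve; _:+_; _:*_; _:=_; con)
  open ℕₚ

  *-cancelˡ-≡′ : ∀ c {m n} → 1 ≤ c → c * m ≡ c * n → m ≡ n
  *-cancelˡ-≡′ c {m} {n} c≥1 = *-cancelˡ-≡ m n c {{>-nonZero c≥1}}

  incidence-step : ∀ q w Z C D J → q * Z ≡ D * J → Z + C ≡ q * C + 1 →
                   D * (J * w) + q * (w * C) ≡ q * q * (w * C) + q * w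
  incidence-step q w Z C D J qZ≡DJ Z+C≡qC+1 = begin
    D * (J * w) + q * (w * C)   ≡⟨ solve 5 (λ D J w q C → D :* (J :* w) :+ q :* (w :* C) := w :* (D :* J) :+ q :* (w :* C))
                                         refl D J w q C ⟩
    w * (D * J) + q * (w * C)   ≡⟨ cong (λ z → w * z + q * (w * C)) (sym qZ≡DJ) ⟩
    w * (q * Z) + q * (w * C)   ≡⟨ solve 4 (λ w q Z C → w :* (q :* Z) :+ q :* (w :* C) := w :* q :* (Z :+ C))
                                         refl w q Z C ⟩
    w * q * (Z + C)             ≡⟨ cong (w * q *_) Z+C≡qC+1 ⟩
    w * q * (q * C + 1)         ≡⟨ solve 3 (λ w q C → w :* q :* (q :* C :+ con 1) := q :* q :* (w :* C) :+ q :* w)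
                                         refl w q C ⟩
    q * q * (w * C) + q * w     ∎
    where open ≡-Reasoning

  -- (q − 1)·(goal) is a combination of h₁ … h₅ with polynomial coefficients; adding the
  -- left-hand sides to one side and the right-hand sides to the other makes it a semiring identity.
  perp-weight-arith : ∀ {q D A R M T S θ m u} → 2 ≤ q →
    D * (q * A + R) + q * S ≡ q * q * S + q * T →
    S + u * M ≡ θ * (m * (u + 1)) →
    D + θ ≡ q * θ + 1 →
    A + R ≡ T →
    T ≡ m * (q * u + 1) →
    D * A + q * u * M ≡ m * (D + q * u)
  perp-weight-arith {suc (suc p)} {D} {A} {R} {M} {T} {S} {θ} {m} {u} (s≤s (s≤s _)) h₁ h₂ h₃ h₄ h₅ =
    *-cancelˡ-≡′ (suc p) (s≤s z≤n)
      (+-cancelʳ-≡ rhs _ _ (combination p D A R M T S θ m u ∙ cong (suc p * (m * (D + q * u)) +_) hyps))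
    where
    q = suc (suc p)
    rhs = (q * q * S + q * T) + q * suc p * (θ * (m * (u + 1))) + q * m * (u + 1) * (D + θ)
        + D * (A + R) + D * T + q * (m * (q * u + 1))
    lhs = (D * (q * A + R) + q * S) + q * suc p * (S + u * M) + q * m * (u + 1) * (q * θ + 1)
        + D * T + D * (m * (q * u + 1)) + q * T
    hyps : lhs ≡ rhs
    hyps rewrite h₁ | h₂ | sym h₃ | h₄ | h₅ = refl
    combination : ∀ p D A R M T S θ m u → let q = 2 + p in
      suc p * (D * A + q * u * M)
        + ((q * q * S + q * T) + q * suc p * (θ * (m * (u + 1))) + q * m * (u + 1) * (D + θ)
           + D * (A + R) + D * T + q * (m * (q * u + 1)))
      ≡ suc p * (m * (D + q * u))
        + ((D * (q * A + R) + q * S) + q * suc p * (S + u * M) + q * m * (u + 1) * (q * θ + 1)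
           + D * T + D * (m * (q * u + 1)) + q * T)
    combination = solve-∀

  total-weight-arith : ∀ {q u S θ m T} → 2 ≤ q → 1 ≤ u →
    (q * u) * (q * u) * T + q * S ≡ q * q * S + q * T →
    S + u * T ≡ θ * (m * (u + 1)) →
    (q * u) * (q * u) + θ ≡ q * θ + 1 →
    T ≡ m * (q * u + 1)
  total-weight-arith {suc (suc p)} {suc u′} {S} {θ} {m} {T} (s≤s (s≤s _)) (s≤s _) h₁ h₂ h₃ =
    *-cancelˡ-≡′ c c≥1
      (+-cancelʳ-≡ rhs _ _ (combination p u′ S θ m T ∙ cong (c * (m * (q * u + 1)) +_) hyps))
    where
    q = suc (suc p)
    u = suc u′
    D = (q * u) * (q * u)
    c = q * (suc p * u + u′) * (u + 1)   -- q(u + 1)(qu − 1)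
    c≥1 : 1 ≤ c
    c≥1 = s≤s z≤n
    rhs = (q * q * S + q * T) + q * suc p * (θ * (m * (u + 1))) + q * m * (u + 1) * (D + θ)
    lhs = (D * T + q * S) + q * suc p * (S + u * T) + q * m * (u + 1) * (q * θ + 1)
    hyps : lhs ≡ rhs
    hyps rewrite h₁ | h₂ | sym h₃ = refl
    combination : ∀ p u′ S θ m T → let q = 2 + p ; u = suc u′ ; D = (q * u) * (q * u) in
      q * (suc p * u + u′) * (u + 1) * T
        + ((q * q * S + q * T) + q * suc p * (θ * (m * (u + 1))) + q * m * (u + 1) * (D + θ))
      ≡ q * (suc p * u + u′) * (u + 1) * (m * (q * u + 1))
        + ((D * T + q * S) + q * suc p * (S + u * T) + q * m * (u + 1) * (q * θ + 1))
    combination = solve-∀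


module WeightCounting (F : FiniteField) {N : ℕ} (B : Geometry.V F N → Geometry.V F N → FiniteField.Carrier F)
  (B-+ : FormProperties.Additiveˡ F B) (B-· : FormProperties.Homogeneousˡ F B)
  (w : Geometry.V F N → ℕ) where

  open FiniteField F using (0#; _==_)
  open Geometry F
  open FormProperties F using (Nondegenerate)
  open FieldFacts F using (q; q≥2; ==-false; ∈-allVecs)
  open VectorAlgebra F using (wholeSpace; lincomb-unit; unit)
  open PointCounting F using (#points)
  open Spans F using (#points-inSpan)
  open FormCounting F B B-+ B-·
  open Arithmetic
  open import Data.Nat using (_+_; _*_; _^_)

  WeightedOvoidWith : (m u : ℕ) → Set
  WeightedOvoidWith m u =
    ∀ p → normalised p ≡ true → weightOf w (λ v → B p v == 0#) + u * w p ≡ m * (u + 1)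

  Σpoints : (V N → ℕ) → ℕ
  Σpoints f = Σ (points N) f

  weightOf-Σpoints : ∀ S → weightOf w S ≡ Σpoints (λ x → [ S x ]* w x)
  weightOf-Σpoints S = Σ-filterᵇ (points N) S w

  Σpoints-cong : ∀ {f g : V N → ℕ} → (∀ v → normalised v ≡ true → f v ≡ g v) → Σpoints f ≡ Σpoints g
  Σpoints-cong {f} {g} f≗g = Σ-filterᵇ (allVecs N) normalised f
                           ∙ Σ-cong (allVecs N) on-points
                           ∙ sym (Σ-filterᵇ (allVecs N) normalised g)
    where
    on-points : ∀ v → [ normalised v ]* f v ≡ [ normalised v ]* g v
    on-points v with normalised v in v-normalised
    ... | true = f≗g v v-normalised
    ... | false = refl

  totalWeight : ℕ
  totalWeight = Σpoints w

  module _ {d : ℕ} (π : Subspace N d) where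
    weightPerp weightNotPerp weightSpan incidences : ℕ
    weightPerp = Σpoints (λ x → [ inPerp B π x ]* w x)
    weightNotPerp = Σpoints (λ x → [ not (inPerp B π x) ]* w x)
    weightSpan = Σpoints (λ p → [ inSpan π p ]* w p)
    incidences = Σpoints (λ x → w x * #points (inSpanPerpTo π x))

    weightPerp+weightNotPerp : weightPerp + weightNotPerp ≡ totalWeight
    weightPerp+weightNotPerp = sym (Σ-+ (points N) _ _) ∙ Σ-cong (points N) (λ x → []*-not (inPerp B π x) (w x))

    -- π ∩ x^⊥ is π itself when x ∈ π^⊥, and a hyperplane of π otherwise.
    incidences-by-perp : q ^ d * (q * weightPerp + weightNotPerp) + q * incidences
                       ≡ q * q * incidences + q * totalWeight
    incidences-by-perp =
        cong₂ _+_ (cong (q ^ d *_) (cong (_+ weightNotPerp) (sym (Σ-*ˡ (points N) q _)) ∙ sym (Σ-+ (points N) _ _))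
                   ∙ sym (Σ-*ˡ (points N) (q ^ d) _))
                  (sym (Σ-*ˡ (points N) q _))
      ∙ sym (Σ-+ (points N) _ _)
      ∙ Σ-cong (points N) at
      ∙ Σ-+ (points N) _ _
      ∙ cong₂ _+_ (Σ-*ˡ (points N) (q * q) _) (Σ-*ˡ (points N) q w)
      where
      C : V N → ℕ
      C x = #points (inSpanPerpTo π x)
      at : ∀ x → q ^ d * (q * [ inPerp B π x ]* w x + [ not (inPerp B π x) ]* w x) + q * (w x * C x)
               ≡ q * q * (w x * C x) + q * w x
      at x with inPerp B π x in x∈π⊥
      ... | true = cong (λ z → q ^ d * z + q * (w x * C x)) (ℕₚ.+-identityʳ _)
                 ∙ incidence-step q (w x) (#annihilating (basis π) x) (C x) (q ^ d) q
                     (q*#annihilating π x ∙ cong (λ b → q ^ d * (if b then q else 1)) x∈π⊥)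
                     (#points-inSpanPerpTo π x)
      ... | false = cong (λ z → q ^ d * z + q * (w x * C x))
                         (cong (_+ w x) (ℕₚ.*-zeroʳ q) ∙ sym (ℕₚ.*-identityˡ (w x)))
                  ∙ incidence-step q (w x) (#annihilating (basis π) x) (C x) (q ^ d) 1
                      (q*#annihilating π x ∙ cong (λ b → q ^ d * (if b then q else 1)) x∈π⊥)
                      (#points-inSpanPerpTo π x)

    incidences-by-ovoid : ∀ {m u} → WeightedOvoidWith m u →
                          incidences + u * weightSpan ≡ #points (inSpan π) * (m * (u + 1))
    incidences-by-ovoid {m} {u} ovoid =
        cong₂ _+_ swap (sym (Σ-*ˡ (points N) u _))
      ∙ sym (Σ-+ (points N) _ _)
      ∙ Σpoints-cong at
      ∙ Σ-cong (points N) (λ p → []*-*1 (inSpan π p) _ ∙ ℕₚ.*-comm _ (m * (u + 1)))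
      ∙ Σ-*ˡ (points N) (m * (u + 1)) (λ p → [ inSpan π p ]* 1)
      ∙ ℕₚ.*-comm _ (#points (inSpan π))
      where
      swap : incidences ≡ Σpoints (λ p → [ inSpan π p ]* Σpoints (λ x → [ B p x == 0# ]* w x))
      swap = Σ-cong (points N) (λ x → sym (Σ-*ˡ (points N) (w x) _)
                                  ∙ Σ-cong (points N) (λ p → ℕₚ.*-comm (w x) _
                                                          ∙ sym ([]*-*1 (inSpanPerpTo π x p) (w x))
                                                          ∙ []*-∧ (inSpan π p) _ (w x)))
           ∙ Σ-comm (points N) (points N) _
           ∙ Σ-cong (points N) (λ p → Σ-[]* (points N) (inSpan π p) (λ x → [ B p x == 0# ]* w x))
      at : ∀ p → normalised p ≡ true →
           [ inSpan π p ]* Σpoints (λ x → [ B p x == 0# ]* w x) + u * [ inSpan π p ]* w p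
           ≡ [ inSpan π p ]* (m * (u + 1))
      at p p-normalised with inSpan π p
      ... | true = cong (_+ u * w p) (sym (weightOf-Σpoints _)) ∙ ovoid p p-normalised
      ... | false = ℕₚ.*-zeroʳ u

  module _ (nondegenerate : Nondegenerate B) where
    private
      whole-not-perp : ∀ x → normalised x ≡ true → inPerp B (wholeSpace N) x ≡ false
      whole-not-perp x x-normalised with nondegenerate x x-normalised
      ... | v , Bvx≢0 = all≡false⁺ (λ c → B (lincomb c unit) x == 0#) (∈-allVecs v)
                          (==-false (λ e → Bvx≢0 (cong (λ z → B z x) (sym (lincomb-unit v)) ∙ e)))

    weightPerp-whole : weightPerp (wholeSpace N) ≡ 0
    weightPerp-whole = Σpoints-cong (λ x x-normalised → cong (λ b → [ b ]* w x) (whole-not-perp x x-normalised))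
                     ∙ Σ-zero (points N) (λ _ → 0) (λ _ → refl)

    weightNotPerp-whole : weightNotPerp (wholeSpace N) ≡ totalWeight
    weightNotPerp-whole = Σpoints-cong (λ x x-normalised → cong (λ b → [ not b ]* w x) (whole-not-perp x x-normalised))

    weightSpan-whole : weightSpan (wholeSpace N) ≡ totalWeight
    weightSpan-whole = Σ-cong (points N) (λ x → cong (λ b → [ b ]* w x)
      (any≡true⁺ (λ c → lincomb c unit ==ᵥ x) (∈-allVecs x) (FieldFacts.==ᵥ-true F (lincomb-unit x))))

    totalWeight-value : ∀ {m u} → WeightedOvoidWith m u → 1 ≤ u → q ^ N ≡ (q * u) * (q * u) →
                        totalWeight ≡ m * (q * u + 1)
    totalWeight-value {m} {u} ovoid u≥1 q^N≡[qu]² =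
      total-weight-arith {q} {u} {incidences π} {#points (inSpan π)} {m} {totalWeight} q≥2 u≥1 h₁ h₂ h₃
      where
      π = wholeSpace N
      perp-part : q * weightPerp π + weightNotPerp π ≡ totalWeight
      perp-part = cong₂ (λ a r → q * a + r) weightPerp-whole weightNotPerp-whole ∙ cong (_+ totalWeight) (ℕₚ.*-zeroʳ q)
      h₁ : (q * u) * (q * u) * totalWeight + q * incidences π ≡ q * q * incidences π + q * totalWeight
      h₁ = cong₂ (λ D t → D * t + q * incidences π) (sym q^N≡[qu]²) (sym perp-part) ∙ incidences-by-perp π
      h₂ : incidences π + u * totalWeight ≡ #points (inSpan π) * (m * (u + 1))
      h₂ = cong (λ z → incidences π + u * z) (sym weightSpan-whole) ∙ incidences-by-ovoid π {m} {u} ovoid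
      h₃ : (q * u) * (q * u) + #points (inSpan π) ≡ q * #points (inSpan π) + 1
      h₃ = cong (_+ #points (inSpan π)) (sym q^N≡[qu]²) ∙ #points-inSpan π

    perp-weight : ∀ {m u} → WeightedOvoidWith m u → 1 ≤ u → q ^ N ≡ (q * u) * (q * u) →
                  ∀ {d} (π : Subspace N d) →
                  q ^ d * weightOf w (inPerp B π) + q * u * weightOf w (inSpan π) ≡ m * (q ^ d + q * u)
    perp-weight {m} {u} ovoid u≥1 q^N≡[qu]² {d} π =
      subst₂ (λ A M → q ^ d * A + q * u * M ≡ m * (q ^ d + q * u))
             (sym (weightOf-Σpoints (inPerp B π))) (sym (weightOf-Σpoints (inSpan π)))
        (perp-weight-arith {R = weightNotPerp π} {m = m} q≥2
                           (incidences-by-perp π) (incidences-by-ovoid π {m} {u} ovoid)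
                           (#points-inSpan π) (weightPerp+weightNotPerp π)
                           (totalWeight-value {m} {u} ovoid u≥1 q^N≡[qu]²))

data Even : ℕ → Set where
  even-zero : Even 0
  even-suc-suc : ∀ {n} → Even n → Even (suc (suc n))

even-2* : ∀ r → Even (2 ℕ.* r)
even-2* zero = even-zero
even-2* (suc r) = subst Even (cong suc (sym (ℕₚ.+-suc r (r ℕ.+ 0)))) (even-suc-suc (even-2* r))

module StandardForms (F : FiniteField) where
  open FiniteField F
  open Geometry F
  open PolarSpaces F
  open FieldFacts F
  open VectorAlgebra F using (·-zeroˡ)
  open FormProperties F
  open import Algebra.Solver.Ring.NaturalCoefficients.Default commutativeSemiring
    using (solve; _:+_; _:*_; _:=_; con)

  normalised-zero : ∀ n → normalised (zeroᵥ {n}) ≡ false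
  normalised-zero zero = refl
  normalised-zero (suc n) rewrite ==-true {0#} {0#} refl = normalised-zero n

  normalised⇒≢0 : ∀ {n} (x : V n) → normalised x ≡ true → ¬ x ≡ zeroᵥ
  normalised⇒≢0 {n} x x-normalised refl with () ← sym x-normalised ∙ normalised-zero n

  -x≢0 : ∀ x → ¬ x ≡ 0# → ¬ (- x) ≡ 0#
  -x≢0 x x≢0 e = x≢0 (-‿injective (e ∙ sym -0#≈0#))

  sympl-additiveˡ : ∀ {n} → Additiveˡ (sympl {n})
  sympl-additiveˡ [] [] [] = sym (+-identityʳ 0#)
  sympl-additiveˡ (_ ∷ []) (_ ∷ []) (_ ∷ []) = sym (+-identityʳ 0#)
  sympl-additiveˡ (u₀ ∷ u₁ ∷ us) (v₀ ∷ v₁ ∷ vs) (x₀ ∷ x₁ ∷ xs) =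
      cong₂ _+_ (cong₂ _+_ (distribʳ x₁ u₀ v₀) (cong -_ (distribʳ x₀ u₁ v₁) ∙ sym (-‿+-comm (u₁ * x₀) (v₁ * x₀))))
                (sympl-additiveˡ us vs xs)
    ∙ solve 6 (λ a b c d e f → ((a :+ b) :+ (c :+ d)) :+ (e :+ f) := ((a :+ c) :+ e) :+ ((b :+ d) :+ f))
              refl _ _ _ _ _ _

  sympl-homogeneousˡ : ∀ {n} → Homogeneousˡ (sympl {n})
  sympl-homogeneousˡ a [] [] = sym (zeroʳ a)
  sympl-homogeneousˡ a (_ ∷ []) (_ ∷ []) = sym (zeroʳ a)
  sympl-homogeneousˡ a (u₀ ∷ u₁ ∷ us) (x₀ ∷ x₁ ∷ xs) =
      cong₂ _+_ (cong₂ _+_ (*-assoc a u₀ x₁) (cong -_ (*-assoc a u₁ x₀) ∙ -‿distribʳ-* a (u₁ * x₀)))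
                (sympl-homogeneousˡ a us xs)
    ∙ cong (_+ a * sympl us xs) (sym (distribˡ a _ _))
    ∙ sym (distribˡ a _ _)

  sympl-nondegenerate : ∀ {n} → Even n → (x : V n) → ¬ x ≡ zeroᵥ → ∃ λ v → ¬ sympl v x ≡ 0#
  sympl-nondegenerate even-zero [] x≢0 = ⊥-elim (x≢0 refl)
  sympl-nondegenerate (even-suc-suc n-even) (x₀ ∷ x₁ ∷ xs) x≢0 with x₁ ≟ 0# | x₀ ≟ 0#
  ... | no x₁≢0 | _ = (1# ∷ 0# ∷ zeroᵥ) , λ e → x₁≢0 (sym value ∙ e)
    where
    value : sympl (1# ∷ 0# ∷ zeroᵥ) (x₀ ∷ x₁ ∷ xs) ≡ x₁
    value = cong₂ _+_ (cong₂ _+_ (*-identityˡ x₁) (cong -_ (zeroˡ x₀) ∙ -0#≈0#) ∙ +-identityʳ x₁)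
                      (homogeneous⇒zeroˡ sympl sympl-homogeneousˡ xs)
          ∙ +-identityʳ x₁
  ... | yes _ | no x₀≢0 = (0# ∷ 1# ∷ zeroᵥ) , λ e → -x≢0 x₀ x₀≢0 (sym value ∙ e)
    where
    value : sympl (0# ∷ 1# ∷ zeroᵥ) (x₀ ∷ x₁ ∷ xs) ≡ - x₀
    value = cong₂ _+_ (cong₂ _+_ (zeroˡ x₁) (cong -_ (*-identityˡ x₀)) ∙ +-identityˡ (- x₀))
                      (homogeneous⇒zeroˡ sympl sympl-homogeneousˡ xs)
          ∙ +-identityʳ (- x₀)
  ... | yes refl | yes refl with sympl-nondegenerate n-even xs (λ { refl → x≢0 refl })
  ...   | v , v-witness = (0# ∷ 0# ∷ v) , λ e → v-witness (sym value ∙ e)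
    where
    value : sympl (0# ∷ 0# ∷ v) (0# ∷ 0# ∷ xs) ≡ sympl v xs
    value = cong (_+ sympl v xs) (cong₂ _+_ (zeroˡ 0#) (cong -_ (zeroˡ 0#) ∙ -0#≈0#) ∙ +-identityˡ 0#)
          ∙ +-identityˡ _

  herm : ∀ {n} → ℕ → V n → V n → Carrier
  herm s u v = Vec.foldr _ _+_ 0# (Vec.zipWith (λ a b → a * (b ^ s)) u v)

  herm-additiveˡ : ∀ {n} s → Additiveˡ (herm {n} s)
  herm-additiveˡ s [] [] [] = sym (+-identityʳ 0#)
  herm-additiveˡ s (a ∷ u) (b ∷ v) (c ∷ x) =
      cong₂ _+_ (distribʳ (c ^ s) a b) (herm-additiveˡ s u v x)
    ∙ solve 4 (λ a b c d → (a :+ b) :+ (c :+ d) := (a :+ c) :+ (b :+ d)) refl _ _ _ _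

  herm-homogeneousˡ : ∀ {n} s → Homogeneousˡ (herm {n} s)
  herm-homogeneousˡ s t [] [] = sym (zeroʳ t)
  herm-homogeneousˡ s t (a ∷ u) (c ∷ x) =
    cong₂ _+_ (*-assoc t a (c ^ s)) (herm-homogeneousˡ s t u x) ∙ sym (distribˡ t _ _)

  ^-≢0 : ∀ x n → ¬ x ≡ 0# → ¬ (x ^ n) ≡ 0#
  ^-≢0 x zero x≢0 = 1≢0
  ^-≢0 x (suc n) x≢0 e = ^-≢0 x n x≢0 (x*y≡0⇒y≡0 x (x ^ n) x≢0 e)

  herm-nondegenerate : ∀ {n} s (x : V n) → ¬ x ≡ zeroᵥ → ∃ λ v → ¬ herm s v x ≡ 0#
  herm-nondegenerate s [] x≢0 = ⊥-elim (x≢0 refl)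
  herm-nondegenerate s (x₀ ∷ xs) x≢0 with x₀ ≟ 0#
  ... | no x₀≢0 = (1# ∷ zeroᵥ) , λ e → ^-≢0 x₀ s x₀≢0 (sym value ∙ e)
    where
    value : herm s (1# ∷ zeroᵥ) (x₀ ∷ xs) ≡ x₀ ^ s
    value = cong₂ _+_ (*-identityˡ _) (homogeneous⇒zeroˡ (herm s) (herm-homogeneousˡ s) xs) ∙ +-identityʳ _
  ... | yes refl with herm-nondegenerate s xs (λ { refl → x≢0 refl })
  ...   | v , v-witness = (0# ∷ v) , λ e → v-witness (sym value ∙ e)
    where
    value : herm s (0# ∷ v) (0# ∷ xs) ≡ herm s v xs
    value = cong (_+ herm s v xs) (zeroˡ _) ∙ +-identityˡ _

  pairPolar : ∀ {n} → V n → V n → Carrier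
  pairPolar (a ∷ b ∷ us) (c ∷ d ∷ vs) = a * d + c * b + pairPolar us vs
  pairPolar _ _ = 0#

  pairPolar-additiveˡ : ∀ {n} → Additiveˡ (pairPolar {n})
  pairPolar-additiveˡ [] [] [] = sym (+-identityʳ 0#)
  pairPolar-additiveˡ (_ ∷ []) (_ ∷ []) (_ ∷ []) = sym (+-identityʳ 0#)
  pairPolar-additiveˡ (a ∷ b ∷ us) (a′ ∷ b′ ∷ vs) (c ∷ d ∷ xs) rewrite pairPolar-additiveˡ us vs xs =
    solve 8 (λ a b a′ b′ c d p p′ → (a :+ a′) :* d :+ c :* (b :+ b′) :+ (p :+ p′)
                                   := (a :* d :+ c :* b :+ p) :+ (a′ :* d :+ c :* b′ :+ p′))
          refl a b a′ b′ c d (pairPolar us xs) (pairPolar vs xs)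

  pairPolar-homogeneousˡ : ∀ {n} → Homogeneousˡ (pairPolar {n})
  pairPolar-homogeneousˡ t [] [] = sym (zeroʳ t)
  pairPolar-homogeneousˡ t (_ ∷ []) (_ ∷ []) = sym (zeroʳ t)
  pairPolar-homogeneousˡ t (a ∷ b ∷ us) (c ∷ d ∷ xs) rewrite pairPolar-homogeneousˡ t us xs =
    solve 6 (λ t a b c d p → (t :* a) :* d :+ c :* (t :* b) :+ t :* p := t :* (a :* d :+ c :* b :+ p))
          refl t a b c d (pairPolar us xs)

  pairSum-polar : ∀ {n} (u v : V n) → pairSum (u +ᵥ v) ≡ (pairSum u + pairSum v) + pairPolar u v
  pairSum-polar [] [] = sym (cong (_+ 0#) (+-identityʳ 0#) ∙ +-identityʳ 0#)
  pairSum-polar (_ ∷ []) (_ ∷ []) = sym (cong (_+ 0#) (+-identityʳ 0#) ∙ +-identityʳ 0#)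
  pairSum-polar (a ∷ b ∷ us) (c ∷ d ∷ vs) rewrite pairSum-polar us vs =
    solve 7 (λ a b c d P P′ Q → (a :+ c) :* (b :+ d) :+ ((P :+ P′) :+ Q)
                               := ((a :* b :+ P) :+ (c :* d :+ P′)) :+ (a :* d :+ c :* b :+ Q))
          refl a b c d (pairSum us) (pairSum vs) (pairPolar us vs)

  pairPolar-nondegenerate : ∀ {n} → Even n → (x : V n) → ¬ x ≡ zeroᵥ → ∃ λ v → ¬ pairPolar v x ≡ 0#
  pairPolar-nondegenerate even-zero [] x≢0 = ⊥-elim (x≢0 refl)
  pairPolar-nondegenerate (even-suc-suc n-even) (c ∷ d ∷ xs) x≢0 with d ≟ 0# | c ≟ 0#
  ... | no d≢0 | _ = (1# ∷ 0# ∷ zeroᵥ) , λ e → d≢0 (sym value ∙ e)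
    where
    value : pairPolar (1# ∷ 0# ∷ zeroᵥ) (c ∷ d ∷ xs) ≡ d
    value = cong₂ _+_ (cong₂ _+_ (*-identityˡ d) (zeroʳ c) ∙ +-identityʳ d)
                      (homogeneous⇒zeroˡ pairPolar pairPolar-homogeneousˡ xs)
          ∙ +-identityʳ d
  ... | yes _ | no c≢0 = (0# ∷ 1# ∷ zeroᵥ) , λ e → c≢0 (sym value ∙ e)
    where
    value : pairPolar (0# ∷ 1# ∷ zeroᵥ) (c ∷ d ∷ xs) ≡ c
    value = cong₂ _+_ (cong₂ _+_ (zeroˡ d) (*-identityʳ c) ∙ +-identityˡ c)
                      (homogeneous⇒zeroˡ pairPolar pairPolar-homogeneousˡ xs)
          ∙ +-identityʳ c
  ... | yes refl | yes refl with pairPolar-nondegenerate n-even xs (λ { refl → x≢0 refl })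
  ...   | v , v-witness = (0# ∷ 0# ∷ v) , λ e → v-witness (sym value ∙ e)
    where
    value : pairPolar (0# ∷ 0# ∷ v) (0# ∷ 0# ∷ xs) ≡ pairPolar v xs
    value = cong (_+ pairPolar v xs) (cong₂ _+_ (zeroˡ 0#) (zeroʳ 0#) ∙ +-identityˡ 0#) ∙ +-identityˡ _

  char2⇒x+x≡0 : 1# + 1# ≡ 0# → ∀ y → y + y ≡ 0#
  char2⇒x+x≡0 char2 y = cong₂ _+_ (sym (*-identityˡ y)) (sym (*-identityˡ y))
                      ∙ sym (distribʳ y 1# 1#) ∙ cong (_* y) char2 ∙ zeroˡ y

  char2⇒square-injective : 1# + 1# ≡ 0# → ∀ t t′ → t * t ≡ t′ * t′ → t ≡ t′
  char2⇒square-injective char2 t t′ t²≡t′² with (t + t′) ≟ 0#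
  ... | yes t+t′≡0 = +-inverseˡ-unique t t′ t+t′≡0 ∙ sym (+-inverseˡ-unique t′ t′ (char2⇒x+x≡0 char2 t′))
  ... | no t+t′≢0 = ⊥-elim (t+t′≢0 (x*y≡0⇒y≡0 (t + t′) (t + t′) t+t′≢0 [t+t′]²≡0))
    where
    [t+t′]²≡0 : (t + t′) * (t + t′) ≡ 0#
    [t+t′]²≡0 = solve 2 (λ t t′ → (t :+ t′) :* (t :+ t′) := (t :* t :+ t′ :* t′) :+ (t :* t′ :+ t :* t′))
                        refl t t′
              ∙ cong₂ _+_ (cong (_+ t′ * t′) t²≡t′² ∙ char2⇒x+x≡0 char2 (t′ * t′)) (char2⇒x+x≡0 char2 (t * t′))
              ∙ +-identityˡ 0#

  module EllipticQuadric (r : ℕ) (α β γ : Carrier) where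
    Q : V (2 ℕ.+ 2 ℕ.* r) → Carrier
    Q = quadForm {r} α β γ

    polar : V (2 ℕ.+ 2 ℕ.* r) → V (2 ℕ.+ 2 ℕ.* r) → Carrier
    polar (u₀ ∷ u₁ ∷ us) (v₀ ∷ v₁ ∷ vs) =
      α * (u₀ * v₀) + α * (u₀ * v₀) + β * (u₀ * v₁ + v₀ * u₁) + γ * (u₁ * v₁) + γ * (u₁ * v₁) + pairPolar us vs

    Q-+ : ∀ u v → Q (u +ᵥ v) ≡ (Q u + Q v) + polar u v
    Q-+ (u₀ ∷ u₁ ∷ us) (v₀ ∷ v₁ ∷ vs) rewrite pairSum-polar us vs =
      solve 10 (λ α β γ u₀ u₁ v₀ v₁ P P′ B →
          α :* (u₀ :+ v₀) :* (u₀ :+ v₀) :+ β :* (u₀ :+ v₀) :* (u₁ :+ v₁) :+ γ :* (u₁ :+ v₁) :* (u₁ :+ v₁)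
            :+ ((P :+ P′) :+ B)
          := ((α :* u₀ :* u₀ :+ β :* u₀ :* u₁ :+ γ :* u₁ :* u₁ :+ P)
              :+ (α :* v₀ :* v₀ :+ β :* v₀ :* v₁ :+ γ :* v₁ :* v₁ :+ P′))
             :+ (α :* (u₀ :* v₀) :+ α :* (u₀ :* v₀) :+ β :* (u₀ :* v₁ :+ v₀ :* u₁)
                 :+ γ :* (u₁ :* v₁) :+ γ :* (u₁ :* v₁) :+ B))
        refl α β γ u₀ u₁ v₀ v₁ (pairSum us) (pairSum vs) (pairPolar us vs)

    Q-polarisation : ∀ u v → (Q (u +ᵥ v) - Q u) - Q v ≡ polar u v
    Q-polarisation u v rewrite Q-+ u v =
        solve 5 (λ a b e na nb → ((a :+ b) :+ e :+ na) :+ nb := e :+ ((a :+ na) :+ (b :+ nb)))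
              refl (Q u) (Q v) (polar u v) (- Q u) (- Q v)
      ∙ cong (polar u v +_) (cong₂ _+_ (-‿inverseʳ (Q u)) (-‿inverseʳ (Q v)) ∙ +-identityˡ 0#)
      ∙ +-identityʳ _

    polar-additiveˡ : Additiveˡ polar
    polar-additiveˡ (u₀ ∷ u₁ ∷ us) (w₀ ∷ w₁ ∷ ws) (x₀ ∷ x₁ ∷ xs) rewrite pairPolar-additiveˡ us ws xs =
      solve 11 (λ α β γ u₀ u₁ w₀ w₁ x₀ x₁ p p′ →
          α :* ((u₀ :+ w₀) :* x₀) :+ α :* ((u₀ :+ w₀) :* x₀) :+ β :* ((u₀ :+ w₀) :* x₁ :+ x₀ :* (u₁ :+ w₁))
            :+ γ :* ((u₁ :+ w₁) :* x₁) :+ γ :* ((u₁ :+ w₁) :* x₁) :+ (p :+ p′)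
          := (α :* (u₀ :* x₀) :+ α :* (u₀ :* x₀) :+ β :* (u₀ :* x₁ :+ x₀ :* u₁)
              :+ γ :* (u₁ :* x₁) :+ γ :* (u₁ :* x₁) :+ p)
             :+ (α :* (w₀ :* x₀) :+ α :* (w₀ :* x₀) :+ β :* (w₀ :* x₁ :+ x₀ :* w₁)
                 :+ γ :* (w₁ :* x₁) :+ γ :* (w₁ :* x₁) :+ p′))
        refl α β γ u₀ u₁ w₀ w₁ x₀ x₁ (pairPolar us xs) (pairPolar ws xs)

    polar-homogeneousˡ : Homogeneousˡ polar
    polar-homogeneousˡ t (u₀ ∷ u₁ ∷ us) (x₀ ∷ x₁ ∷ xs) rewrite pairPolar-homogeneousˡ t us xs =
      solve 9 (λ t α β γ u₀ u₁ x₀ x₁ p →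
          α :* ((t :* u₀) :* x₀) :+ α :* ((t :* u₀) :* x₀) :+ β :* ((t :* u₀) :* x₁ :+ x₀ :* (t :* u₁))
            :+ γ :* ((t :* u₁) :* x₁) :+ γ :* ((t :* u₁) :* x₁) :+ t :* p
          := t :* (α :* (u₀ :* x₀) :+ α :* (u₀ :* x₀) :+ β :* (u₀ :* x₁ :+ x₀ :* u₁)
                   :+ γ :* (u₁ :* x₁) :+ γ :* (u₁ :* x₁) :+ p))
        refl t α β γ u₀ u₁ x₀ x₁ (pairPolar us xs)

    polar-00 : ∀ v x₀ x₁ xs → polar (0# ∷ 0# ∷ v) (x₀ ∷ x₁ ∷ xs) ≡ pairPolar v xs
    polar-00 v x₀ x₁ xs =
      solve 6 (λ α β γ x₀ x₁ p →
          α :* (con 0 :* x₀) :+ α :* (con 0 :* x₀) :+ β :* (con 0 :* x₁ :+ x₀ :* con 0)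
            :+ γ :* (con 0 :* x₁) :+ γ :* (con 0 :* x₁) :+ p := p)
        refl α β γ x₀ x₁ (pairPolar v xs)

    polar-e₀ : ∀ x₀ x₁ xs → polar (1# ∷ 0# ∷ zeroᵥ) (x₀ ∷ x₁ ∷ xs) ≡ α * x₀ + α * x₀ + β * x₁
    polar-e₀ x₀ x₁ xs =
        solve 7 (λ α β γ x₀ x₁ one p →
            α :* (one :* x₀) :+ α :* (one :* x₀) :+ β :* (one :* x₁ :+ x₀ :* con 0)
              :+ γ :* (con 0 :* x₁) :+ γ :* (con 0 :* x₁) :+ p
            := (α :* (one :* x₀) :+ α :* (one :* x₀) :+ β :* (one :* x₁)) :+ p)
          refl α β γ x₀ x₁ 1# (pairPolar zeroᵥ xs)
      ∙ cong₂ _+_ (cong₂ _+_ (cong₂ _+_ (cong (α *_) (*-identityˡ x₀)) (cong (α *_) (*-identityˡ x₀)))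
                             (cong (β *_) (*-identityˡ x₁)))
                  (homogeneous⇒zeroˡ pairPolar pairPolar-homogeneousˡ xs)
      ∙ +-identityʳ _

    polar-e₁ : ∀ x₀ x₁ xs → polar (0# ∷ 1# ∷ zeroᵥ) (x₀ ∷ x₁ ∷ xs) ≡ β * x₀ + γ * x₁ + γ * x₁
    polar-e₁ x₀ x₁ xs =
        solve 7 (λ α β γ x₀ x₁ one p →
            α :* (con 0 :* x₀) :+ α :* (con 0 :* x₀) :+ β :* (con 0 :* x₁ :+ x₀ :* one)
              :+ γ :* (one :* x₁) :+ γ :* (one :* x₁) :+ p
            := (β :* (x₀ :* one) :+ γ :* (one :* x₁) :+ γ :* (one :* x₁)) :+ p)
          refl α β γ x₀ x₁ 1# (pairPolar zeroᵥ xs)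
      ∙ cong₂ _+_ (cong₂ _+_ (cong₂ _+_ (cong (β *_) (*-identityʳ x₀)) (cong (γ *_) (*-identityˡ x₁)))
                             (cong (γ *_) (*-identityˡ x₁)))
                  (homogeneous⇒zeroˡ pairPolar pairPolar-homogeneousˡ xs)
      ∙ +-identityʳ _

    module _ (anisotropic : Anisotropic α β γ) where
      -- If β = 0 then α ≠ 0 and Q(t, 1) = 0 for the square root t of γ/α, which exists because
      -- squaring is injective, hence surjective, on a finite field of characteristic 2.
      char2⇒β≢0 : 1# + 1# ≡ 0# → ¬ β ≡ 0#
      char2⇒β≢0 char2 β≡0 with α ≟ 0#
      ... | yes α≡0 = 1≢0 (proj₁ (anisotropic 1# 0# Q[1,0]≡0))
        where
        Q[1,0]≡0 : α * 1# * 1# + β * 1# * 0# + γ * 0# * 0# ≡ 0#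
        Q[1,0]≡0 = solve 4 (λ α β γ one → α :* one :* one :+ β :* one :* con 0 :+ γ :* con 0 :* con 0
                                          := α :* one :* one) refl α β γ 1#
                 ∙ cong (λ z → z * 1# * 1#) α≡0 ∙ cong (_* 1#) (zeroˡ 1#) ∙ zeroˡ 1#
      ... | no α≢0 with injective⇒surjective (λ t → t * t) (char2⇒square-injective char2) (α ⁻¹ * γ)
      ...   | t , t²≡γ/α = 1≢0 (proj₂ (anisotropic t 1# Q[t,1]≡0))
        where
        Q[t,1]≡0 : α * t * t + β * t * 1# + γ * 1# * 1# ≡ 0#
        Q[t,1]≡0 = cong₂ _+_ (cong₂ _+_ (*-assoc α t t ∙ cong (α *_) t²≡γ/α ∙ *⁻¹-cancel α γ α≢0)
                                        (cong (λ z → z * t * 1#) β≡0 ∙ cong (_* 1#) (zeroˡ t) ∙ zeroˡ 1#)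
                             ∙ +-identityʳ γ)
                             (*-identityʳ (γ * 1#) ∙ *-identityʳ γ)
                 ∙ char2⇒x+x≡0 char2 γ

      -- Outside characteristic 2, x₀·∂₀ + x₁·∂₁ = 2·Q(x₀, x₁); in characteristic 2 the partials
      -- are β x₁ and β x₀.
      partials-nonvanishing : ∀ x₀ x₁ → ¬ (x₀ ≡ 0# × x₁ ≡ 0#) →
        α * x₀ + α * x₀ + β * x₁ ≡ 0# → β * x₀ + γ * x₁ + γ * x₁ ≡ 0# → ⊥
      partials-nonvanishing x₀ x₁ x≢0 ∂₀≡0 ∂₁≡0 with (1# + 1#) ≟ 0#
      ... | no char≢2 = x≢0 (anisotropic x₀ x₁ (x*y≡0⇒y≡0 (1# + 1#) _ char≢2 2Q≡0))
        where
        Q₀ = α * x₀ * x₀ + β * x₀ * x₁ + γ * x₁ * x₁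
        euler : x₀ * (α * x₀ + α * x₀ + β * x₁) + x₁ * (β * x₀ + γ * x₁ + γ * x₁) ≡ Q₀ + Q₀
        euler = solve 5 (λ α β γ x₀ x₁ →
                    x₀ :* (α :* x₀ :+ α :* x₀ :+ β :* x₁) :+ x₁ :* (β :* x₀ :+ γ :* x₁ :+ γ :* x₁)
                    := (α :* x₀ :* x₀ :+ β :* x₀ :* x₁ :+ γ :* x₁ :* x₁)
                       :+ (α :* x₀ :* x₀ :+ β :* x₀ :* x₁ :+ γ :* x₁ :* x₁))
                  refl α β γ x₀ x₁
        2Q≡0 : (1# + 1#) * Q₀ ≡ 0#
        2Q≡0 = distribʳ Q₀ 1# 1# ∙ cong₂ _+_ (*-identityˡ Q₀) (*-identityˡ Q₀) ∙ sym euler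
             ∙ cong₂ _+_ (cong (x₀ *_) ∂₀≡0 ∙ zeroʳ x₀) (cong (x₁ *_) ∂₁≡0 ∙ zeroʳ x₁) ∙ +-identityˡ 0#
      ... | yes char2 = x≢0 (x*y≡0⇒y≡0 β x₀ β≢0 βx₀≡0 , x*y≡0⇒y≡0 β x₁ β≢0 βx₁≡0)
        where
        β≢0 = char2⇒β≢0 char2
        βx₁≡0 : β * x₁ ≡ 0#
        βx₁≡0 = sym (+-identityˡ _) ∙ cong (_+ β * x₁) (sym (char2⇒x+x≡0 char2 (α * x₀))) ∙ ∂₀≡0
        βx₀≡0 : β * x₀ ≡ 0#
        βx₀≡0 = sym (+-identityʳ _) ∙ cong (β * x₀ +_) (sym (char2⇒x+x≡0 char2 (γ * x₁)))
              ∙ sym (+-assoc _ _ _) ∙ ∂₁≡0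

      polar-nondegenerate : ∀ (x : V (2 ℕ.+ 2 ℕ.* r)) → ¬ x ≡ zeroᵥ → ∃ λ v → ¬ polar v x ≡ 0#
      polar-nondegenerate (x₀ ∷ x₁ ∷ xs) x≢0 with ≡-dec _≟_ xs zeroᵥ
      ... | no xs≢0 with pairPolar-nondegenerate (even-2* r) xs xs≢0
      ...   | v , v-witness = (0# ∷ 0# ∷ v) , λ e → v-witness (sym (polar-00 v x₀ x₁ xs) ∙ e)
      polar-nondegenerate (x₀ ∷ x₁ ∷ xs) x≢0 | yes refl with (α * x₀ + α * x₀ + β * x₁) ≟ 0#
      ... | no ∂₀≢0 = (1# ∷ 0# ∷ zeroᵥ) , λ e → ∂₀≢0 (sym (polar-e₀ x₀ x₁ xs) ∙ e)
      ... | yes ∂₀≡0 with (β * x₀ + γ * x₁ + γ * x₁) ≟ 0#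
      ...   | no ∂₁≢0 = (0# ∷ 1# ∷ zeroᵥ) , λ e → ∂₁≢0 (sym (polar-e₁ x₀ x₁ xs) ∙ e)
      ...   | yes ∂₁≡0 = ⊥-elim (partials-nonvanishing x₀ x₁ (λ { (refl , refl) → x≢0 refl }) ∂₀≡0 ∂₁≡0)

module WeightEqualities (F : FiniteField) where
  open PolarSpaces F using (WeightEq)
  open import Data.Nat using (_+_; _*_; _^_; >-nonZero)
  open import Data.Integer using (+_; -[1+_])
  open +-*-Solver using (solve; _:+_; _:*_; _:=_; con)
  open Arithmetic using (*-cancelˡ-≡′)

  +[m+n]-+m≡+n : ∀ m n → + (m + n) ℤ.- + m ≡ + n
  +[m+n]-+m≡+n m n = ℤₚ.m-n≡m⊖n (m + n) m ∙ ℤₚ.⊖-≥ (ℕₚ.m≤m+n m n) ∙ cong +_ (ℕₚ.m+n∸m≡n m n)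

  +m-+[m+1+n]≡-[1+n] : ∀ m n → + m ℤ.- + (m + suc n) ≡ -[1+ n ]
  +m-+[m+1+n]≡-[1+n] m n =
    ℤₚ.m-n≡m⊖n m (m + suc n) ∙ ℤₚ.⊖-< (ℕₚ.m<m+n m (s≤s z≤n)) ∙ cong (λ z → ℤ.- (+ z)) (ℕₚ.m+n∸m≡n m (suc n))

  weightEq-intro : ∀ b e f {A M m} → 1 ≤ b →
                   b ^ f * A + b ^ e * M ≡ m * (b ^ f + b ^ e) → WeightEq b (+ e ℤ.- + f) A M m
  weightEq-intro b e f {A} {M} {m} b≥1 eq with ℕₚ.≤-<-connex f e
  ... | inj₁ f≤e with n , refl ← ℕₚ.m≤n⇒∃[o]m+o≡n f≤e =
    subst (λ z → WeightEq b z A M m) (sym (+[m+n]-+m≡+n f n))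
      (*-cancelˡ-≡′ (b ^ f) (ℕₚ.m^n>0 b {{>-nonZero b≥1}} f) (begin
        b ^ f * (A + b ^ n * M)            ≡⟨ solve 4 (λ P A x M → P :* (A :+ x :* M) := P :* A :+ (P :* x) :* M)
                                                    refl (b ^ f) A (b ^ n) M ⟩
        b ^ f * A + (b ^ f * b ^ n) * M    ≡⟨ cong (λ z → b ^ f * A + z * M) (sym (ℕₚ.^-distribˡ-+-* b f n)) ⟩
        b ^ f * A + b ^ (f + n) * M        ≡⟨ eq ⟩
        m * (b ^ f + b ^ (f + n))          ≡⟨ cong (λ z → m * (b ^ f + z)) (ℕₚ.^-distribˡ-+-* b f n) ⟩
        m * (b ^ f + b ^ f * b ^ n)        ≡⟨ solve 3 (λ m P x → m :* (P :+ P :* x) := P :* (m :* (x :+ con 1)))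
                                                    refl m (b ^ f) (b ^ n) ⟩
        b ^ f * (m * (b ^ n + 1))          ∎))
    where open ≡-Reasoning
  ... | inj₂ e<f with n , refl ← ℕₚ.m≤n⇒∃[o]m+o≡n e<f =
    subst (λ z → WeightEq b z A M m)
          (sym (cong (λ z → + e ℤ.- + z) (sym (ℕₚ.+-suc e n)) ∙ +m-+[m+1+n]≡-[1+n] e n))
      (*-cancelˡ-≡′ (b ^ e) (ℕₚ.m^n>0 b {{>-nonZero b≥1}} e) (begin
        b ^ e * (b ^ suc n * A + M)                  ≡⟨ solve 4 (λ P x A M → P :* (x :* A :+ M) := (P :* x) :* A :+ P :* M)
                                                              refl (b ^ e) (b ^ suc n) A M ⟩
        (b ^ e * b ^ suc n) * A + b ^ e * M          ≡⟨ cong (λ z → z * A + b ^ e * M) (sym b^[e+1+n]) ⟩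
        b ^ (suc e + n) * A + b ^ e * M              ≡⟨ eq ⟩
        m * (b ^ (suc e + n) + b ^ e)                ≡⟨ cong (λ z → m * (z + b ^ e)) b^[e+1+n] ⟩
        m * (b ^ e * b ^ suc n + b ^ e)              ≡⟨ solve 3 (λ m P x → m :* (P :* x :+ P) := P :* (m :* (con 1 :+ x)))
                                                              refl m (b ^ e) (b ^ suc n) ⟩
        b ^ e * (m * (1 + b ^ suc n))                ∎))
    where
    open ≡-Reasoning
    b^[e+1+n] : b ^ (suc e + n) ≡ b ^ e * b ^ suc n
    b^[e+1+n] = cong (b ^_) (sym (ℕₚ.+-suc e n)) ∙ ℕₚ.^-distribˡ-+-* b e (suc n)

module PolarSpaceParameters (F : FiniteField) where
  open FiniteField F using (order)
  open Geometry F
  open PolarSpaces F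
  open FieldFacts F using (q≥2)
  open FormProperties F
  open StandardForms F
  open WeightEqualities F using (+[m+n]-+m≡+n)
  open import Data.Nat using (_+_; _*_; _^_)
  open import Data.Integer using (+_)
  open +-*-Solver using (solve; _:+_; _:*_; _:=_; con)

  -- With q = base^g and q^(r+e-2) = base^k: the ambient vector space has dimension 2(r + e − 1),
  -- so g·coords = 2(g + k), and the exponent r + e − 2 − j becomes g + k − g·d for d = j + 1.
  record Parameters {r : ℕ} (P : PolarSpace r) : Set where
    field
      g k : ℕ
      base^g≡q : base P ^ g ≡ order
      expo≡ : ∀ d → expo P d ≡ + (g + k) ℤ.- + (g * d)
      g*coords≡ : g * coords P ≡ (g + k) + (g + k)
      base≥1 : 1 ≤ base P
      form-additiveˡ : Additiveˡ (form P)
      form-homogeneousˡ : Homogeneousˡ (form P)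
      form-nondegenerate : Nondegenerate (form P)

    u : ℕ
    u = base P ^ k

    q^d≡base^[g*d] : ∀ d → order ^ d ≡ base P ^ (g * d)
    q^d≡base^[g*d] d = cong (_^ d) (sym base^g≡q) ∙ ℕₚ.^-*-assoc (base P) g d

    q*u≡base^[g+k] : order * u ≡ base P ^ (g + k)
    q*u≡base^[g+k] = cong (_* u) (sym base^g≡q) ∙ sym (ℕₚ.^-distribˡ-+-* (base P) g k)

    q^coords≡[qu]² : order ^ coords P ≡ (order * u) * (order * u)
    q^coords≡[qu]² = q^d≡base^[g*d] (coords P) ∙ cong (base P ^_) g*coords≡
                   ∙ ℕₚ.^-distribˡ-+-* (base P) (g + k) (g + k) ∙ sym (cong₂ _*_ q*u≡base^[g+k] q*u≡base^[g+k])

    expo-1≡+k : expo P 1 ≡ + k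
    expo-1≡+k = expo≡ 1 ∙ cong (λ z → + (g + k) ℤ.- + z) (ℕₚ.*-identityʳ g) ∙ +[m+n]-+m≡+n g k

    u≥1 : 1 ≤ u
    u≥1 = ℕₚ.m^n>0 (base P) {{ℕ.>-nonZero base≥1}} k

  q≥1 : 1 ≤ order
  q≥1 = ℕₚ.≤-trans (s≤s z≤n) q≥2

  parameters : ∀ r → 1 ≤ r → (P : PolarSpace r) → Parameters P
  parameters r r≥1 (ellipticQuadric α β γ anisotropic) = record
    { g = 1 ; k = r
    ; base^g≡q = ℕₚ.*-identityʳ order
    ; expo≡ = λ d → cong₂ (λ y z → + y ℤ.- + z) (ℕₚ.+-comm r 1) (sym (ℕₚ.*-identityˡ d))
    ; g*coords≡ = solve 1 (λ r → con 1 :* (con 2 :+ con 2 :* r) := (con 1 :+ r) :+ (con 1 :+ r)) refl r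
    ; base≥1 = q≥1
    ; form-additiveˡ = λ u v x → Q-polarisation (u +ᵥ v) x ∙ polar-additiveˡ u v x
                                ∙ sym (cong₂ _+ᶠ_ (Q-polarisation u x) (Q-polarisation v x))
    ; form-homogeneousˡ = λ a u x → Q-polarisation (a · u) x ∙ polar-homogeneousˡ a u x
                                  ∙ sym (cong (a *ᶠ_) (Q-polarisation u x))
    ; form-nondegenerate = λ x x-normalised →
        let (v , v-witness) = polar-nondegenerate anisotropic x (normalised⇒≢0 x x-normalised)
        in v , λ e → v-witness (sym (Q-polarisation v x) ∙ e)
    }
    where
    open EllipticQuadric r α β γ
    open FiniteField F using () renaming (_+_ to _+ᶠ_; _*_ to _*ᶠ_)
  parameters (suc r) r≥1 symplectic = record
    { g = 1 ; k = r
    ; base^g≡q = ℕₚ.*-identityʳ order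
    ; expo≡ = λ d → cong (λ z → + suc r ℤ.- + z) (sym (ℕₚ.*-identityˡ d))
    ; g*coords≡ = solve 1 (λ r → con 1 :* (con 2 :* (con 1 :+ r)) := (con 1 :+ r) :+ (con 1 :+ r)) refl r
    ; base≥1 = q≥1
    ; form-additiveˡ = sympl-additiveˡ
    ; form-homogeneousˡ = sympl-homogeneousˡ
    ; form-nondegenerate = λ x x-normalised →
        sympl-nondegenerate (even-2* (suc r)) x (normalised⇒≢0 x x-normalised)
    }
  parameters (suc r) r≥1 (hermitian s s²≡q) = record
    { g = 2 ; k = 2 * r + 1
    ; base^g≡q = cong (s *_) (ℕₚ.*-identityʳ s) ∙ s²≡q
    ; expo≡ = λ d → cong (λ y → + y ℤ.- + (2 * d))
                         (solve 1 (λ r → con 2 :* (con 1 :+ r) :+ con 1 := con 2 :+ (con 2 :* r :+ con 1)) refl r)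
    ; g*coords≡ = solve 1 (λ r → con 2 :* (con 1 :+ con 2 :* (con 1 :+ r))
                               := (con 2 :+ (con 2 :* r :+ con 1)) :+ (con 2 :+ (con 2 :* r :+ con 1))) refl r
    ; base≥1 = s≥1 s s²≡q
    ; form-additiveˡ = herm-additiveˡ s
    ; form-homogeneousˡ = herm-homogeneousˡ s
    ; form-nondegenerate = λ x x-normalised → herm-nondegenerate s x (normalised⇒≢0 x x-normalised)
    }
    where
    s≥1 : ∀ s → s * s ≡ order → 1 ≤ s
    s≥1 zero s²≡q with () ← subst (2 ≤_) (sym s²≡q) q≥2
    s≥1 (suc _) _ = s≤s z≤n

lemma3p1 : (F : FiniteField) (r : ℕ) → 1 ≤ r →
    let open Geometry F
        open PolarSpaces F
    in (P : PolarSpace r) (μ : V (coords P) → ℕ) (m : ℕ) →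
       WeightedOvoid P μ m →
       (d : ℕ) → d ≤ coords P → (π : Subspace (coords P) d) →
       WeightEq (base P) (expo P d) (μ[_⊥] P μ π) (μ[_] P μ π) m
lemma3p1 F r r≥1 P μ m ovoid d _ π =
  subst (λ z → WeightEq (base P) z (μ[_⊥] P μ π) (μ[_] P μ π) m) (sym (expo≡ d))
    (weightEq-intro (base P) (g + k) (g * d) base≥1
      (subst₂ (λ X Y → X * μ[_⊥] P μ π + Y * μ[_] P μ π ≡ m * (X + Y)) (q^d≡base^[g*d] d) q*u≡base^[g+k]
        (perp-weight form-nondegenerate {m} {u} ovoid-with-u u≥1 q^coords≡[qu]² π)))
  where
  open Geometry F
  open PolarSpaces F
  open PolarSpaceParameters.Parameters (PolarSpaceParameters.parameters F r r≥1 P)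
  open WeightCounting F (form P) form-additiveˡ form-homogeneousˡ (μ̃ P μ)
  open WeightEqualities F using (weightEq-intro)
  open FiniteField F using (_==_; 0#)
  open import Data.Nat using (_+_; _*_)
  ovoid-with-u : WeightedOvoidWith m u
  ovoid-with-u p p-normalised =
    subst (λ z → WeightEq (base P) z (weightOf (μ̃ P μ) (λ v → form P p v == 0#)) (μ̃ P μ p) m)
          expo-1≡+k (ovoid p p-normalised)
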